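{- Fix any step, with request $R$ of cardinality at most $r$, and consider its first stage. In this stage DLM pays its access cost and performs all its reordering for this step. The offline algorithm Off, with current permutation $\pi^*$, pays its access cost $\Delta\mathrm{Off}=\min_{u\in R}\pi^*(u)$ and does not change $\pi^*$. Then $$\Delta\mathrm{DLM}+\Delta\Phi+\Delta\Psi\le(3+\alpha)\cdot 2^{\kappa+1}\cdot\Delta\mathrm{Off}=O(r)\cdot\Delta\mathrm{Off}.$$
   Context: Online Min-Sum Set Cover with requests of cardinality at most $r$, over a universe $\mathcal U$ of $n$ elements. Lists are permutations $\mathcal U\to\{1,\dots,n\}$. Reordering costs one unit per swap of adjacent elements. Algorithm DLM. Every element $z$ has a budget $b(z)$, initially $0$. The operation fetch$(z)$ moves $z$ to position 1 by $\pi(z)-1$ adjacent swaps (cost $\pi(z)-1$), so every element that preceded $z$ moves back by one position, and then sets $b(z)\gets0$. On a request $R$ with $|R|=s$, let $x\in R$ be the element of $R$ with the smallest current position and let $\ell=\pi(x)$. DLM pays access cost $\ell$ and executes fetch$(x)$. For every $y\in R\setminus\{x\}$ it sets $b(y)\gets b(y)+\ell/s$. Then, while some $z$ has $b(z)\ge\pi(z)$, it executes fetch$(z)$. Potentials. Let $\pi$ be DLM's current permutation and $\pi^*$ the current permutation of Off. Write $\pi(z)=2^{p(z)}+q(z)$ with $p(z)\ge0$ an integer and $0\le q(z)\le 2^{p(z)}-1$, and analogously $\pi^*(z)=2^{p^*(z)}+q^*(z)$. Set $\alpha=2$, $\gamma=5r$, $\beta=7.5r+5$ and $\kappa=\lceil\log_2(6\beta)\rceil$.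 Define - $\Phi_z=\alpha\, b(z)$ if $p(z)\le p^*(z)+\kappa$, and $\Phi_z=\beta\,\pi(z)-\gamma\, b(z)$ if $p(z)\ge p^*(z)+\kappa+1$; - $\Psi_z=0$ if $p(z)\le p^*(z)+\kappa-1$, and $\Psi_z=2\beta\, q(z)$ if $p(z)\ge p^*(z)+\kappa$. Set $\Phi=\sum_{z}\Phi_z$ and $\Psi=\sum_z\Psi_z$. $\Delta\mathrm{DLM}$ is DLM's total cost (access plus reordering) in this stage, and $\Delta\Phi$, $\Delta\Psi$ are the changes of the potentials over the stage. -}

module Defs where

open import Data.Nat as ℕ using (ℕ; zero; suc; _∸_; _^_)
open import Data.Nat.Logarithm using (⌊log₂_⌋; ⌈log₂_⌉)
open import Data.Integer using (+_)
open import Data.Rational as ℚ using (ℚ; _/_; 0ℚ; _+_; _*_; _-_; _≤_; _<_)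
open import Data.Fin using (Fin; _≟_)
open import Data.List using (List; []; _∷_; length; filter; foldr; map; allFin)
open import Data.List.Membership.Propositional using (_∈_)
import Data.List.Membership.DecPropositional as DMP
open import Data.List.Relation.Unary.Unique.Propositional using (Unique)
open import Data.List.Relation.Binary.Permutation.Propositional using (_↭_)
open import Data.Bool using (Bool; true; false; if_then_else_; _∧_; not)
open import Relation.Nullary using (¬_; ¬?; does)
open import Relation.Binary.PropositionalEquality using (_≡_)
open import Data.Product using (_×_)

⟦_⟧ : ℕ → ℚ
⟦ k ⟧ = + k / 1

-- a / s as a rational (s ≥ 1 whenever used; value 0 for s = 0 is irrelevant)
divℕ : ℕ → ℕ → ℚ
divℕ a zero    = 0ℚ
divℕ a (suc k) = + a / suc k

module _ {n : ℕ} where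

  module DecMem = DMP (_≟_ {n = n})

  -- A list is a linear ordering of the universe Fin n (head = position 1).
  IsList : List (Fin n) → Set
  IsList L = L ↭ allFin n

  pos : List (Fin n) → Fin n → ℕ
  pos []      z = 1
  pos (y ∷ L) z = if does (y ≟ z) then 1 else suc (pos L z)

  -- fetch(z) on the list: move z to the front (cost pos L z ∸ 1 adjacent swaps)
  fetchL : List (Fin n) → Fin n → List (Fin n)
  fetchL L z = z ∷ filter (λ y → ¬? (y ≟ z)) L

  setB : (Fin n → ℚ) → Fin n → ℚ → (Fin n → ℚ)
  setB b z v y = if does (y ≟ z) then v else b y

  record State : Set where
    constructor ⟨_,_⟩
    field
      lst : List (Fin n)
      bud : Fin n → ℚ
  open State public

  ValidReq : ℕ → List (Fin n) → Set
  ValidReq r R = Unique R × (1 ℕ.≤ length R) × (length R ℕ.≤ r)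

  IsFirst : List (Fin n) → List (Fin n) → Fin n → Set
  IsFirst L R x = x ∈ R × (∀ u → u ∈ R → pos L x ℕ.≤ pos L u)

  raise : List (Fin n) → Fin n → ℚ → (Fin n → ℚ) → (Fin n → ℚ)
  raise R x δ b y =
    if does (y DecMem.∈? R) ∧ not (does (y ≟ x)) then b y + δ else b y

  -- The while-loop: "while some z has b(z) ≥ π(z), fetch(z)".
  -- Loop s c s' : starting from s, the loop can end in s' with reordering cost c.
  data Loop : State → ℕ → State → Set where
    done : ∀ {L b} → (∀ z → b z < ⟦ pos L z ⟧) → Loop ⟨ L , b ⟩ 0 ⟨ L , b ⟩
    step : ∀ {L b c s'} z → ⟦ pos L z ⟧ ≤ b z →
           Loop ⟨ fetchL L z , setB b z 0ℚ ⟩ c s' →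
           Loop ⟨ L , b ⟩ (pos L z ∸ 1 ℕ.+ c) s'

  data DLMStep (R : List (Fin n)) : State → ℕ → State → Set where
    serve : ∀ {L b c s'} x → IsFirst L R x →
            Loop ⟨ fetchL L x ,
                   raise R x (divℕ (pos L x) (length R)) (setB b x 0ℚ) ⟩ c s' →
            DLMStep R ⟨ L , b ⟩ (pos L x ℕ.+ (pos L x ∸ 1) ℕ.+ c) s'

  data Reachable (r : ℕ) : State → Set where
    init : ∀ L → IsList L → Reachable r ⟨ L , (λ _ → 0ℚ) ⟩
    next : ∀ {s c s'} R → ValidReq r R → Reachable r s → DLMStep R s c s' →
           Reachable r s'

  minPos : List (Fin n) → List (Fin n) → ℕ
  minPos L* []      = 0
  minPos L* (u ∷ []) = pos L* u
  minPos L* (u ∷ R@(_ ∷ _)) = ℕ._⊓_ (pos L* u) (minPos L* R)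

  Σᵤ : (Fin n → ℚ) → ℚ
  Σᵤ f = foldr (λ z acc → f z + acc) 0ℚ (allFin n)

α : ℚ
α = ⟦ 2 ⟧

γ : ℕ → ℚ
γ r = ⟦ 5 ℕ.* r ⟧

β : ℕ → ℚ
β r = + (15 ℕ.* r ℕ.+ 10) / 2

κ : ℕ → ℕ
κ r = ⌈log₂ (45 ℕ.* r ℕ.+ 30) ⌉    -- ⌈log₂(6β)⌉, 6β = 45 r + 30

-- π = 2^p + q with 0 ≤ q ≤ 2^p − 1, i.e. p = ⌊log₂ π⌋, q = π − 2^p
pexp : ℕ → ℕ
pexp m = ⌊log₂ m ⌋

qrem : ℕ → ℕ
qrem m = m ∸ 2 ^ ⌊log₂ m ⌋

module _ {n : ℕ} (r : ℕ) where

  Φz : State {n} → List (Fin n) → Fin n → ℚ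
  Φz s L* z with pexp (pos (lst s) z) ℕ.≤? pexp (pos L* z) ℕ.+ κ r
  ... | Relation.Nullary.yes _ = α * bud s z
  ... | Relation.Nullary.no  _ = β r * ⟦ pos (lst s) z ⟧ - γ r * bud s z

  Ψz : State {n} → List (Fin n) → Fin n → ℚ
  Ψz s L* z with pexp (pos (lst s) z) ℕ.<? pexp (pos L* z) ℕ.+ κ r
  ... | Relation.Nullary.yes _ = 0ℚ
  ... | Relation.Nullary.no  _ = ⟦ 2 ⟧ * β r * ⟦ qrem (pos (lst s) z) ⟧

  Φ : State {n} → List (Fin n) → ℚ
  Φ s L* = Σᵤ (Φz s L*)

  Ψ : State {n} → List (Fin n) → ℚ
  Ψ s L* = Σᵤ (Ψz s L*)

-- Φ + Ψ is a sum over the elements z of a quantity pot(π(z), π*(z), b(z)).  Fetching an element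
-- from position P moves the elements in front of it back by one position; such a move raises pot
-- by at most 3β, and only when 2^κ·π* < 2P, which holds for at most 2P/2^κ elements.  As
-- 6β ≤ 2^κ, a fetch gains at most P besides the fall of the fetched element's pot to 0, and that
-- fall is at least 2P for the fetches of the loop (budget ≥ P), which pays for them.  Serving x at
-- position ℓ costs at most 2ℓ for access and swaps plus ℓ for the overtaken elements, and raising
-- the budgets of R ∖ {x} by ℓ/|R| adds at most αℓ.  This (3 + α)ℓ is charged through the element
-- u of R accessed by Off: if p(u) ≤ p*(u) + κ then ℓ ≤ π(u) < 2^(κ+1)·π*(u); otherwise pot(x) ≥ 5ℓ
-- when u = x, and when u ≠ x the raise lowers pot(u) by γℓ/|R| instead of raising it by αℓ/|R|,
-- and (α + γ)ℓ/|R| ≥ 5ℓ because |R| ≤ r.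

module Submission where

open import Defs
open import Data.Nat as ℕ using (ℕ; zero; suc; z≤n; s≤s; _^_; ⌊_/2⌋; ⌈_/2⌉)
import Data.Nat.Properties as ℕP
import Data.Nat.DivMod as ℕD
open import Data.Nat.Logarithm
import Data.Nat.Coprimality as Coprime
import Data.Integer as ℤ
import Data.Integer.Properties as ℤP
open import Data.Rational as ℚ using (ℚ; _+_; _-_; _*_; -_; _≤_; _<_; 0ℚ; toℚᵘ)
import Data.Rational.Properties as ℚP
open import Data.Rational.Unnormalised as ℚᵘ using (mkℚᵘ; *≡*; *≤*; *<*)
import Data.Rational.Unnormalised.Properties as ℚᵘP
open import Data.Rational.Solver using (module +-*-Solver)
open +-*-Solver using (solve; _:=_; con; _:+_; _:*_; _:-_)
open import Data.Fin using (Fin; _≟_)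
open import Data.List using (List; []; _∷_; length; foldr; filter; allFin)
import Data.List.Properties as ListP
open import Data.List.Membership.Propositional.Properties using (∈-allFin)
open import Data.List.Relation.Unary.Unique.Propositional.Properties using (allFin⁺)
import Data.List.Relation.Binary.Permutation.Setoid.Properties as PermutationSetoidP
open import Data.List.Membership.Propositional using (_∈_; _∉_)
import Data.List.Membership.DecPropositional as DecMembership
open import Data.List.Relation.Unary.Any using (here; there)
open import Data.List.Relation.Unary.All as All using (All)
open import Data.List.Relation.Unary.AllPairs using (_∷_)
open import Data.List.Relation.Unary.Unique.Propositional using (Unique)
open import Data.List.Relation.Binary.Permutation.Propositional as ↭ using (_↭_)
open import Data.Product using (_×_; _,_; ∃; proj₁; proj₂)
open import Data.Sum using (_⊎_; inj₁; inj₂; [_,_]′)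
open import Relation.Nullary using (Dec; yes; no; ¬_; ¬?; contradiction)
open import Relation.Binary.Definitions using (DecidableEquality; Tri; tri<; tri≈; tri>)
open import Relation.Binary.PropositionalEquality
  using (_≡_; _≢_; refl; sym; trans; cong; cong₂; subst; subst₂; setoid; module ≡-Reasoning)

toℚᵘ-⟦⟧ : ∀ k → toℚᵘ ⟦ k ⟧ ≡ mkℚᵘ (ℤ.+ k) 0
toℚᵘ-⟦⟧ k = cong toℚᵘ (ℚP.normalize-coprime (Coprime.sym (Coprime.1-coprimeTo k)))

⟦+⟧ : ∀ a b → ⟦ a ℕ.+ b ⟧ ≡ ⟦ a ⟧ + ⟦ b ⟧
⟦+⟧ a b = ℚP.toℚᵘ-injective (begin
  toℚᵘ ⟦ a ℕ.+ b ⟧                    ≡⟨ toℚᵘ-⟦⟧ (a ℕ.+ b) ⟩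
  mkℚᵘ (ℤ.+ (a ℕ.+ b)) 0              ≈⟨ *≡* eq ⟩
  mkℚᵘ (ℤ.+ a) 0 ℚᵘ.+ mkℚᵘ (ℤ.+ b) 0  ≡⟨ cong₂ ℚᵘ._+_ (toℚᵘ-⟦⟧ a) (toℚᵘ-⟦⟧ b) ⟨
  toℚᵘ ⟦ a ⟧ ℚᵘ.+ toℚᵘ ⟦ b ⟧          ≈⟨ ℚP.toℚᵘ-homo-+ ⟦ a ⟧ ⟦ b ⟧ ⟨
  toℚᵘ (⟦ a ⟧ + ⟦ b ⟧)                ∎)
  where
  open ℚᵘP.≃-Reasoning
  eq : ℤ.+ (a ℕ.+ b) ℤ.* ℤ.1ℤ ≡ ((ℤ.+ a) ℤ.* ℤ.1ℤ ℤ.+ (ℤ.+ b) ℤ.* ℤ.1ℤ) ℤ.* ℤ.1ℤ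
  eq rewrite ℤP.*-identityʳ (ℤ.+ a) | ℤP.*-identityʳ (ℤ.+ b) = refl

⟦*⟧ : ∀ a b → ⟦ a ℕ.* b ⟧ ≡ ⟦ a ⟧ * ⟦ b ⟧
⟦*⟧ a b = ℚP.toℚᵘ-injective (begin
  toℚᵘ ⟦ a ℕ.* b ⟧                    ≡⟨ toℚᵘ-⟦⟧ (a ℕ.* b) ⟩
  mkℚᵘ (ℤ.+ (a ℕ.* b)) 0              ≈⟨ *≡* (cong (ℤ._* ℤ.1ℤ) (ℤP.pos-* a b)) ⟩
  mkℚᵘ (ℤ.+ a) 0 ℚᵘ.* mkℚᵘ (ℤ.+ b) 0  ≡⟨ cong₂ ℚᵘ._*_ (toℚᵘ-⟦⟧ a) (toℚᵘ-⟦⟧ b) ⟨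
  toℚᵘ ⟦ a ⟧ ℚᵘ.* toℚᵘ ⟦ b ⟧          ≈⟨ ℚP.toℚᵘ-homo-* ⟦ a ⟧ ⟦ b ⟧ ⟨
  toℚᵘ (⟦ a ⟧ * ⟦ b ⟧)                ∎)
  where open ℚᵘP.≃-Reasoning

⟦⟧-mono-≤ : ∀ {a b} → a ℕ.≤ b → ⟦ a ⟧ ≤ ⟦ b ⟧
⟦⟧-mono-≤ {a} {b} a≤b = ℚP.toℚᵘ-cancel-≤
  (subst₂ ℚᵘ._≤_ (sym (toℚᵘ-⟦⟧ a)) (sym (toℚᵘ-⟦⟧ b)) (*≤* (ℤP.*-monoʳ-≤-nonNeg (ℤ.+ 1) (ℤ.+≤+ a≤b))))

⟦⟧-mono-< : ∀ {a b} → a ℕ.< b → ⟦ a ⟧ < ⟦ b ⟧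
⟦⟧-mono-< {a} {b} a<b = ℚP.toℚᵘ-cancel-<
  (subst₂ ℚᵘ._<_ (sym (toℚᵘ-⟦⟧ a)) (sym (toℚᵘ-⟦⟧ b)) (*<* (ℤP.*-monoʳ-<-pos (ℤ.+ 1) (ℤ.+<+ a<b))))

divℕ-*-cancel : ∀ a {s} → 1 ℕ.≤ s → divℕ a s * ⟦ s ⟧ ≡ ⟦ a ⟧
divℕ-*-cancel a {suc k} _ = ℚP.toℚᵘ-injective (begin
  toℚᵘ (divℕ a (suc k) * ⟦ suc k ⟧)          ≈⟨ ℚP.toℚᵘ-homo-* (divℕ a (suc k)) ⟦ suc k ⟧ ⟩
  toℚᵘ (divℕ a (suc k)) ℚᵘ.* toℚᵘ ⟦ suc k ⟧  ≈⟨ ℚᵘP.*-cong (ℚP.toℚᵘ-fromℚᵘ (mkℚᵘ (ℤ.+ a) k))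
                                                            (ℚᵘP.≃-reflexive (toℚᵘ-⟦⟧ (suc k))) ⟩
  mkℚᵘ (ℤ.+ a) k ℚᵘ.* mkℚᵘ (ℤ.+ suc k) 0     ≈⟨ *≡* (ℤP.*-assoc (ℤ.+ a) (ℤ.+ suc k) ℤ.1ℤ) ⟩
  mkℚᵘ (ℤ.+ a) 0                             ≡⟨ toℚᵘ-⟦⟧ a ⟨
  toℚᵘ ⟦ a ⟧                                 ∎)
  where open ℚᵘP.≃-Reasoning

0≤divℕ : ∀ a s → 0ℚ ≤ divℕ a s
0≤divℕ a zero    = ℚP.≤-refl
0≤divℕ a (suc k) = ℚP.nonNegative⁻¹ (divℕ a (suc k)) {{ℚP.normalize-nonNeg a (suc k)}}

*-cancelˡ-≤-2 : ∀ {p q} → ⟦ 2 ⟧ * p ≤ ⟦ 2 ⟧ * q → p ≤ q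
*-cancelˡ-≤-2 = ℚP.*-cancelˡ-≤-pos ⟦ 2 ⟧ {{ℚ.positive (⟦⟧-mono-< {0} {2} (s≤s z≤n))}}

≤-by-gap : ∀ {x y} d → 0ℚ ≤ d → x + d ≡ y → x ≤ y
≤-by-gap {x} d 0≤d refl = subst (_≤ x + d) (ℚP.+-identityʳ x) (ℚP.+-monoʳ-≤ x 0≤d)

0≤+ : ∀ {a b} → 0ℚ ≤ a → 0ℚ ≤ b → 0ℚ ≤ a + b
0≤+ = ℚP.+-mono-≤

0≤* : ∀ {a b} → 0ℚ ≤ a → 0ℚ ≤ b → 0ℚ ≤ a * b
0≤* {a} {b} 0≤a 0≤b = ℚP.nonNegative⁻¹ (a * b)
  {{ℚP.nonNeg*nonNeg⇒nonNeg a {{ℚ.nonNegative 0≤a}} b {{ℚ.nonNegative 0≤b}}}}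

0≤- : ∀ {a b} → a ≤ b → 0ℚ ≤ b - a
0≤- {a} {b} a≤b = subst (_≤ b - a) (ℚP.+-inverseʳ a) (ℚP.+-monoˡ-≤ (- a) a≤b)

0≤⟦⟧ : ∀ k → 0ℚ ≤ ⟦ k ⟧
0≤⟦⟧ k = ⟦⟧-mono-≤ {0} {k} z≤n

*-monoˡ-≤-0≤ : ∀ {c p q} → 0ℚ ≤ c → p ≤ q → c * p ≤ c * q
*-monoˡ-≤-0≤ {c} 0≤c = ℚP.*-monoˡ-≤-nonNeg c {{ℚ.nonNegative 0≤c}}

when : ∀ {p} {P : Set p} → Dec P → ℚ → ℚ
when (yes _) c = c
when (no _)  c = 0ℚ

module _ {p} {P : Set p} {c : ℚ} where

  when-nonneg : (d : Dec P) → 0ℚ ≤ c → 0ℚ ≤ when d c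
  when-nonneg (yes _) 0≤c = 0≤c
  when-nonneg (no _)  _   = ℚP.≤-refl

  when-yes : P → (d : Dec P) → when d c ≡ c
  when-yes _ (yes _) = refl
  when-yes p (no ¬p) = contradiction p ¬p

  when-no : ¬ P → (d : Dec P) → when d c ≡ 0ℚ
  when-no ¬p (yes p) = contradiction p ¬p
  when-no _  (no _)  = refl

when-⇔ : ∀ {p q} {P : Set p} {Q : Set q} {c} → (P → Q) → (Q → P) →
         (d : Dec P) (e : Dec Q) → when d c ≡ when e c
when-⇔ P⇒Q Q⇒P (yes p) e = sym (when-yes (P⇒Q p) e)
when-⇔ P⇒Q Q⇒P (no ¬p) e = sym (when-no (λ q → ¬p (Q⇒P q)) e)

module _ {a} {A : Set a} where

  sumOf : List A → (A → ℚ) → ℚ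
  sumOf L f = foldr (λ z acc → f z + acc) 0ℚ L

  sumOf-mono : ∀ L {f g : A → ℚ} → (∀ y → f y ≤ g y) → sumOf L f ≤ sumOf L g
  sumOf-mono []      f≤g = ℚP.≤-refl
  sumOf-mono (v ∷ L) f≤g = ℚP.+-mono-≤ (f≤g v) (sumOf-mono L f≤g)

  sumOf-cong : ∀ L {f g : A → ℚ} → (∀ y → y ∈ L → f y ≡ g y) → sumOf L f ≡ sumOf L g
  sumOf-cong []      f≡g = refl
  sumOf-cong (v ∷ L) f≡g = cong₂ _+_ (f≡g v (here refl)) (sumOf-cong L (λ y y∈L → f≡g y (there y∈L)))

  sumOf-zero : ∀ L {f : A → ℚ} → (∀ y → y ∈ L → f y ≡ 0ℚ) → sumOf L f ≡ 0ℚ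
  sumOf-zero []      f≡0 = refl
  sumOf-zero (v ∷ L) f≡0 = cong₂ _+_ (f≡0 v (here refl)) (sumOf-zero L (λ y y∈L → f≡0 y (there y∈L)))

  sumOf-+ : ∀ L (f g : A → ℚ) → sumOf L (λ y → f y + g y) ≡ sumOf L f + sumOf L g
  sumOf-+ []      f g = refl
  sumOf-+ (v ∷ L) f g = trans (cong ((f v + g v) +_) (sumOf-+ L f g))
    (solve 4 (λ a b c d → a :+ b :+ (c :+ d) := a :+ c :+ (b :+ d)) refl (f v) (g v) (sumOf L f) (sumOf L g))

  sumOf-↭ : ∀ {L L'} (f : A → ℚ) → L ↭ L' → sumOf L f ≡ sumOf L' f
  sumOf-↭ f ↭.refl         = refl
  sumOf-↭ f (↭.prep x p)   = cong (f x +_) (sumOf-↭ f p)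
  sumOf-↭ {x ∷ y ∷ _} {.y ∷ .x ∷ L'} f (↭.swap .x .y p) = trans (cong (λ t → f x + (f y + t)) (sumOf-↭ f p))
    (solve 3 (λ a b c → a :+ (b :+ c) := b :+ (a :+ c)) refl (f x) (f y) (sumOf L' f))
  sumOf-↭ f (↭.trans p q)  = trans (sumOf-↭ f p) (sumOf-↭ f q)

module Indicators {A : Set} (_≟ᴬ_ : DecidableEquality A) where
  open DecMembership _≟ᴬ_ using (_∈?_)

  sumOf-point : ∀ {L} w c → Unique L → w ∈ L → sumOf L (λ y → when (y ≟ᴬ w) c) ≡ c
  sumOf-point {v ∷ L} w c (v∉L ∷ _) (here refl) = begin
    when (w ≟ᴬ w) c + sumOf L (λ y → when (y ≟ᴬ w) c) ≡⟨ cong₂ _+_ (when-yes refl (w ≟ᴬ w)) (sumOf-zero L off) ⟩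
    c + 0ℚ                                          ≡⟨ ℚP.+-identityʳ c ⟩
    c                                               ∎
    where
    open ≡-Reasoning
    off : ∀ y → y ∈ L → when (y ≟ᴬ w) c ≡ 0ℚ
    off y y∈L = when-no (λ y≡w → All.lookup v∉L y∈L (sym y≡w)) (y ≟ᴬ w)
  sumOf-point {v ∷ L} w c (v∉L ∷ L!) (there w∈L) = begin
    when (v ≟ᴬ w) c + sumOf L (λ y → when (y ≟ᴬ w) c) ≡⟨ cong₂ _+_ (when-no (All.lookup v∉L w∈L) (v ≟ᴬ w)) (sumOf-point w c L! w∈L) ⟩
    0ℚ + c                                          ≡⟨ ℚP.+-identityˡ c ⟩
    c                                               ∎
    where open ≡-Reasoning

  sumOf-member-≤ : ∀ {U} R c → Unique U → (∀ y → y ∈ U) → 0ℚ ≤ c →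
                   sumOf U (λ y → when (y ∈? R) c) ≤ ⟦ length R ⟧ * c
  sumOf-member-≤ {U} [] c U! all∈U 0≤c =
    ℚP.≤-reflexive (trans (sumOf-zero U (λ y _ → refl)) (sym (ℚP.*-zeroˡ c)))
  sumOf-member-≤ {U} (w ∷ R) c U! all∈U 0≤c = begin
    sumOf U (λ y → when (y ∈? w ∷ R) c)                     ≤⟨ sumOf-mono U split ⟩
    sumOf U (λ y → when (y ≟ᴬ w) c + when (y ∈? R) c)       ≡⟨ sumOf-+ U (λ y → when (y ≟ᴬ w) c) (λ y → when (y ∈? R) c) ⟩
    sumOf U (λ y → when (y ≟ᴬ w) c) + sumOf U (λ y → when (y ∈? R) c)
                                                            ≤⟨ ℚP.+-mono-≤ (ℚP.≤-reflexive (sumOf-point w c U! (all∈U w)))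
                                                                           (sumOf-member-≤ R c U! all∈U 0≤c) ⟩
    c + ⟦ length R ⟧ * c                                    ≡⟨ solve 2 (λ c k → c :+ k :* c := (con ⟦ 1 ⟧ :+ k) :* c) refl c ⟦ length R ⟧ ⟩
    (⟦ 1 ⟧ + ⟦ length R ⟧) * c                              ≡⟨ cong (_* c) (⟦+⟧ 1 (length R)) ⟨
    ⟦ length (w ∷ R) ⟧ * c                                  ∎
    where
    open ℚP.≤-Reasoning
    split : ∀ y → when (y ∈? w ∷ R) c ≤ when (y ≟ᴬ w) c + when (y ∈? R) c
    split y with y ≟ᴬ w | y ∈? R | y ∈? w ∷ R
    ... | yes _  | d     | yes _ = ≤-by-gap (when d c) (when-nonneg d 0≤c) refl
    ... | no _   | yes _ | yes _ = ℚP.≤-reflexive (sym (ℚP.+-identityˡ c))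
    ... | no y≢w | no y∉R | yes (here y≡w) = contradiction y≡w y≢w
    ... | no _   | no y∉R | yes (there y∈R) = contradiction y∈R y∉R
    ... | d      | e     | no _  = 0≤+ (when-nonneg d 0≤c) (when-nonneg e 0≤c)

-- Dyadic decomposition m = 2 ^ pexp m + qrem m

⌊log₂⌋-≤ : ∀ k m → m ℕ.< 2 ^ suc k → ⌊log₂ m ⌋ ℕ.≤ k
⌊log₂⌋-≤ zero    zero          _ = z≤n
⌊log₂⌋-≤ zero    (suc zero)    _ = z≤n
⌊log₂⌋-≤ zero    (suc (suc m)) (s≤s (s≤s ()))
⌊log₂⌋-≤ (suc k) m m<2^k+2 = ℕP.≤-trans (ℕP.m≤n+m∸n ⌊log₂ m ⌋ 1) (s≤s halved)
  where
  half< : ⌊ m /2⌋ ℕ.< 2 ^ suc k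
  half< = ℕP.≰⇒> λ 2^k+1≤half → ℕP.<⇒≱ m<2^k+2 (begin
    2 ^ suc (suc k)         ≡⟨ cong (2 ^ suc k ℕ.+_) (ℕP.+-identityʳ (2 ^ suc k)) ⟩
    2 ^ suc k ℕ.+ 2 ^ suc k ≤⟨ ℕP.+-mono-≤ 2^k+1≤half (ℕP.≤-trans 2^k+1≤half (ℕP.⌊n/2⌋≤⌈n/2⌉ m)) ⟩
    ⌊ m /2⌋ ℕ.+ ⌈ m /2⌉     ≡⟨ ℕP.⌊n/2⌋+⌈n/2⌉≡n m ⟩
    m                       ∎)
    where open ℕP.≤-Reasoning
  halved : ⌊log₂ m ⌋ ℕ.∸ 1 ℕ.≤ k
  halved = subst (ℕ._≤ k) (⌊log₂⌊n/2⌋⌋≡⌊log₂n⌋∸1 m) (⌊log₂⌋-≤ k ⌊ m /2⌋ half<)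

≤-⌊log₂⌋ : ∀ k m → 2 ^ k ℕ.≤ m → k ℕ.≤ ⌊log₂ m ⌋
≤-⌊log₂⌋ k m 2^k≤m = subst (ℕ._≤ ⌊log₂ m ⌋) (⌊log₂[2^n]⌋≡n k) (⌊log₂⌋-mono-≤ 2^k≤m)

2^pexp≤ : ∀ m → 1 ℕ.≤ m → 2 ^ pexp m ℕ.≤ m
2^pexp≤ m 1≤m = ℕP.≮⇒≥ (not-below (pexp m) refl)
  where
  not-below : ∀ p → pexp m ≡ p → ¬ m ℕ.< 2 ^ p
  not-below zero    _    m<1 = ℕP.<⇒≱ m<1 1≤m
  not-below (suc k) pexp≡ m< = ℕP.n≮n k (subst (ℕ._≤ k) pexp≡ (⌊log₂⌋-≤ k m m<))

<2^suc-pexp : ∀ m → m ℕ.< 2 ^ suc (pexp m)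
<2^suc-pexp m = ℕP.≰⇒> λ 2^p+1≤m → ℕP.n≮n (pexp m) (≤-⌊log₂⌋ (suc (pexp m)) m 2^p+1≤m)

qrem+2^pexp : ∀ m → 1 ℕ.≤ m → qrem m ℕ.+ 2 ^ pexp m ≡ m
qrem+2^pexp m 1≤m = ℕP.m∸n+n≡m (2^pexp≤ m 1≤m)

data DyadicSucc (m : ℕ) : Set where
  same-block : pexp (suc m) ≡ pexp m → qrem (suc m) ≡ suc (qrem m) → DyadicSucc m
  new-block  : pexp (suc m) ≡ suc (pexp m) → qrem (suc m) ≡ 0 →
               suc m ≡ 2 ℕ.* suc (qrem m) → DyadicSucc m

dyadicSucc : ∀ m → 1 ℕ.≤ m → DyadicSucc m
dyadicSucc m 1≤m with suc m ℕ.<? 2 ^ suc (pexp m)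
... | yes 1+m< = same-block pexp≡ (begin
  suc m ℕ.∸ 2 ^ pexp (suc m) ≡⟨ cong (λ p → suc m ℕ.∸ 2 ^ p) pexp≡ ⟩
  suc m ℕ.∸ 2 ^ pexp m       ≡⟨ ℕP.+-∸-assoc 1 (2^pexp≤ m 1≤m) ⟩
  suc (qrem m)               ∎)
  where
  open ≡-Reasoning
  pexp≡ : pexp (suc m) ≡ pexp m
  pexp≡ = ℕP.≤-antisym (⌊log₂⌋-≤ (pexp m) (suc m) 1+m<) (⌊log₂⌋-mono-≤ (ℕP.n≤1+n m))
... | no ¬1+m< = new-block pexp≡ qrem≡0 (trans 1+m≡ (cong (2 ℕ.*_) (sym 1+qrem≡)))
  where
  1+m≡ : suc m ≡ 2 ^ suc (pexp m)
  1+m≡ = ℕP.≤-antisym (<2^suc-pexp m) (ℕP.≮⇒≥ ¬1+m<)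
  pexp≡ : pexp (suc m) ≡ suc (pexp m)
  pexp≡ = trans (cong pexp 1+m≡) (⌊log₂[2^n]⌋≡n (suc (pexp m)))
  qrem≡0 : qrem (suc m) ≡ 0
  qrem≡0 = trans (cong (λ p → suc m ℕ.∸ 2 ^ p) pexp≡)
                 (trans (cong (ℕ._∸ 2 ^ suc (pexp m)) 1+m≡) (ℕP.n∸n≡0 (2 ^ suc (pexp m))))
  1+qrem≡ : suc (qrem m) ≡ 2 ^ pexp m
  1+qrem≡ = ℕP.+-cancelʳ-≡ (2 ^ pexp m) (suc (qrem m)) (2 ^ pexp m)
    (trans (cong suc (qrem+2^pexp m 1≤m))
           (trans 1+m≡ (cong (2 ^ pexp m ℕ.+_) (ℕP.+-identityʳ (2 ^ pexp m)))))

dyadic-scale-< : ∀ {a b} k j → 1 ℕ.≤ b → pexp a ℕ.+ k ℕ.≤ pexp b ℕ.+ j →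
                 2 ^ k ℕ.* a ℕ.< 2 ^ suc j ℕ.* b
dyadic-scale-< {a} {b} k j 1≤b exps≤ = begin-strict
  2 ^ k ℕ.* a                   <⟨ ℕP.*-monoʳ-< (2 ^ k) {{ℕP.m^n≢0 2 k}} (<2^suc-pexp a) ⟩
  2 ^ k ℕ.* 2 ^ suc (pexp a)    ≡⟨ ℕP.^-distribˡ-+-* 2 k (suc (pexp a)) ⟨
  2 ^ (k ℕ.+ suc (pexp a))      ≡⟨ cong (2 ^_) (trans (ℕP.+-suc k (pexp a)) (cong suc (ℕP.+-comm k (pexp a)))) ⟩
  2 ^ suc (pexp a ℕ.+ k)        ≤⟨ ℕP.^-monoʳ-≤ 2 (s≤s exps≤) ⟩
  2 ^ suc (pexp b ℕ.+ j)        ≡⟨ cong (2 ^_) (cong suc (ℕP.+-comm (pexp b) j)) ⟩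
  2 ^ (suc j ℕ.+ pexp b)        ≡⟨ ℕP.^-distribˡ-+-* 2 (suc j) (pexp b) ⟩
  2 ^ suc j ℕ.* 2 ^ pexp b      ≤⟨ ℕP.*-monoʳ-≤ (2 ^ suc j) (2^pexp≤ b 1≤b) ⟩
  2 ^ suc j ℕ.* b               ∎
  where open ℕP.≤-Reasoning

≤2^⌈log₂⌉ : ∀ k n → ⌈log₂ n ⌉ ℕ.≤ k → n ℕ.≤ 2 ^ k
≤2^⌈log₂⌉ zero    zero          _ = z≤n
≤2^⌈log₂⌉ zero    (suc zero)    _ = s≤s z≤n
≤2^⌈log₂⌉ zero    (suc (suc n)) ⌈log₂⌉≤0 =
  contradiction (ℕP.≤-trans (⌈log₂⌉-mono-≤ {2} {suc (suc n)} (s≤s (s≤s z≤n))) ⌈log₂⌉≤0) λ ()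
≤2^⌈log₂⌉ (suc k) n ⌈log₂⌉≤k+1 = begin
  n                         ≡⟨ ℕP.⌊n/2⌋+⌈n/2⌉≡n n ⟨
  ⌊ n /2⌋ ℕ.+ ⌈ n /2⌉       ≤⟨ ℕP.+-mono-≤ (ℕP.≤-trans (ℕP.⌊n/2⌋≤⌈n/2⌉ n) half≤) half≤ ⟩
  2 ^ k ℕ.+ 2 ^ k           ≡⟨ cong (2 ^ k ℕ.+_) (ℕP.+-identityʳ (2 ^ k)) ⟨
  2 ^ suc k                 ∎
  where
  open ℕP.≤-Reasoning
  half≤ : ⌈ n /2⌉ ℕ.≤ 2 ^ k
  half≤ = ≤2^⌈log₂⌉ k ⌈ n /2⌉
    (subst (ℕ._≤ k) (sym (⌈log₂⌈n/2⌉⌉≡⌈log₂n⌉∸1 n)) (ℕP.∸-monoˡ-≤ 1 ⌈log₂⌉≤k+1))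

κ-pos : ∀ r → 1 ℕ.≤ κ r
κ-pos r = ⌈log₂⌉-mono-≤ {2} {45 ℕ.* r ℕ.+ 30} (ℕP.≤-trans (s≤s (s≤s z≤n)) (ℕP.m≤n+m 30 (45 ℕ.* r)))

β*2≡ : ∀ r → β r * ⟦ 2 ⟧ ≡ ⟦ 15 ⟧ * ⟦ r ⟧ + ⟦ 10 ⟧
β*2≡ r = trans (divℕ-*-cancel (15 ℕ.* r ℕ.+ 10) {2} (s≤s z≤n)) (trans (⟦+⟧ (15 ℕ.* r) 10) (cong (_+ ⟦ 10 ⟧) (⟦*⟧ 15 r)))

γ≡ : ∀ r → γ r ≡ ⟦ 5 ⟧ * ⟦ r ⟧
γ≡ r = ⟦*⟧ 5 r

0≤β : ∀ r → 0ℚ ≤ β r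
0≤β r = 0≤divℕ (15 ℕ.* r ℕ.+ 10) 2

0≤γ : ∀ r → 0ℚ ≤ γ r
0≤γ r = 0≤⟦⟧ (5 ℕ.* r)

6β≤2^κ : ∀ r → ⟦ 6 ⟧ * β r ≤ ⟦ 2 ^ κ r ⟧
6β≤2^κ r = begin
  ⟦ 6 ⟧ * β r                       ≡⟨ solve 1 (λ b → con ⟦ 6 ⟧ :* b := con ⟦ 3 ⟧ :* (b :* con ⟦ 2 ⟧)) refl (β r) ⟩
  ⟦ 3 ⟧ * (β r * ⟦ 2 ⟧)             ≡⟨ cong (⟦ 3 ⟧ *_) (β*2≡ r) ⟩
  ⟦ 3 ⟧ * (⟦ 15 ⟧ * ⟦ r ⟧ + ⟦ 10 ⟧) ≡⟨ solve 1 (λ x → con ⟦ 3 ⟧ :* (con ⟦ 15 ⟧ :* x :+ con ⟦ 10 ⟧) := con ⟦ 45 ⟧ :* x :+ con ⟦ 30 ⟧) refl ⟦ r ⟧ ⟩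
  ⟦ 45 ⟧ * ⟦ r ⟧ + ⟦ 30 ⟧           ≡⟨ trans (⟦+⟧ (45 ℕ.* r) 30) (cong (_+ ⟦ 30 ⟧) (⟦*⟧ 45 r)) ⟨
  ⟦ 45 ℕ.* r ℕ.+ 30 ⟧               ≤⟨ ⟦⟧-mono-≤ (≤2^⌈log₂⌉ (κ r) (45 ℕ.* r ℕ.+ 30) ℕP.≤-refl) ⟩
  ⟦ 2 ^ κ r ⟧                       ∎
  where open ℚP.≤-Reasoning

-- Positions in a list

module _ {n : ℕ} where

  without : Fin n → List (Fin n) → List (Fin n)
  without z = filter (λ y → ¬? (y ≟ z))

  IsList⇒Unique : ∀ {L} → IsList L → Unique L
  IsList⇒Unique L↭ = PermutationSetoidP.Unique-resp-↭ (setoid (Fin n)) (↭.↭⇒↭ₛ (↭.↭-sym L↭)) (allFin⁺ n)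

  IsList⇒∈ : ∀ {L} → IsList L → ∀ z → z ∈ L
  IsList⇒∈ L↭ z = PermutationSetoidP.∈-resp-↭ (setoid (Fin n)) (↭.↭⇒↭ₛ (↭.↭-sym L↭)) (∈-allFin z)

  without-∉ : ∀ {z} {L : List (Fin n)} → All (z ≢_) L → without z L ≡ L
  without-∉ {z} z∉L = ListP.filter-all (λ y → ¬? (y ≟ z)) (All.map (λ z≢y y≡z → z≢y (sym y≡z)) z∉L)

  pos-head : ∀ v (L : List (Fin n)) → pos (v ∷ L) v ≡ 1
  pos-head v L with v ≟ v
  ... | yes _   = refl
  ... | no v≢v = contradiction refl v≢v

  pos-there : ∀ {v y} (L : List (Fin n)) → v ≢ y → pos (v ∷ L) y ≡ suc (pos L y)
  pos-there {v} {y} L v≢y with v ≟ y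
  ... | yes v≡y = contradiction v≡y v≢y
  ... | no _    = refl

  1≤pos : ∀ (L : List (Fin n)) y → 1 ℕ.≤ pos L y
  1≤pos []      y = s≤s z≤n
  1≤pos (v ∷ L) y with v ≟ y
  ... | yes _ = s≤s z≤n
  ... | no _  = s≤s z≤n

  pos-injective : ∀ (L : List (Fin n)) {y z} → y ∈ L → pos L y ≡ pos L z → y ≡ z
  pos-injective (v ∷ L) {y} {z} y∈ eq with v ≟ y | v ≟ z
  ... | yes v≡y | yes v≡z = trans (sym v≡y) v≡z
  ... | yes _   | no _    = contradiction (ℕP.suc-injective (sym eq)) (ℕP.>⇒≢ (1≤pos L z))
  ... | no _    | yes _   = contradiction (ℕP.suc-injective eq) (ℕP.>⇒≢ (1≤pos L y))
  ... | no v≢y  | no _    with y∈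
  ...   | here y≡v   = contradiction (sym y≡v) v≢y
  ...   | there y∈L = pos-injective L y∈L (ℕP.suc-injective eq)

  pos-without-before : ∀ (L : List (Fin n)) {y z} → pos L y ℕ.< pos L z → pos (without z L) y ≡ pos L y
  pos-without-before []      (s≤s ())
  pos-without-before (w ∷ L) {y} {z} y<z with w ≟ z | w ≟ y
  ... | yes _ | yes _    = contradiction y<z λ { (s≤s ()) }
  ... | yes _ | no _     = contradiction y<z λ { (s≤s ()) }
  ... | no _  | yes refl = pos-head w (without z L)
  ... | no _  | no w≢y   = trans (pos-there (without z L) w≢y) (cong suc (pos-without-before L (ℕP.≤-pred y<z)))

  pos-without-after : ∀ (L : List (Fin n)) {y z} → Unique L → pos L z ℕ.< pos L y →
                      suc (pos (without z L) y) ≡ pos L y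
  pos-without-after []      _ (s≤s ())
  pos-without-after (w ∷ L) {y} {z} (w∉L ∷ L!) z<y with w ≟ z | w ≟ y
  ... | yes _     | yes _ = contradiction z<y λ { (s≤s ()) }
  ... | no _      | yes _ = contradiction z<y λ { (s≤s ()) }
  ... | yes refl  | no _  = cong (λ K → suc (pos K y)) (without-∉ w∉L)
  ... | no _      | no w≢y = cong suc (trans (pos-there (without z L) w≢y) (pos-without-after L L! (ℕP.≤-pred z<y)))

  pos-fetchL-self : ∀ (L : List (Fin n)) z → pos (fetchL L z) z ≡ 1
  pos-fetchL-self L z = pos-head z (without z L)

  pos-fetchL-before : ∀ (L : List (Fin n)) {y z} → pos L y ℕ.< pos L z →
                      pos (fetchL L z) y ≡ suc (pos L y)
  pos-fetchL-before L {y} {z} y<z =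
    trans (pos-there {z} {y} (without z L) λ { refl → ℕP.<-irrefl refl y<z }) (cong suc (pos-without-before L y<z))

  pos-fetchL-after : ∀ (L : List (Fin n)) {y z} → Unique L → pos L z ℕ.< pos L y →
                     pos (fetchL L z) y ≡ pos L y
  pos-fetchL-after L {y} {z} L! z<y =
    trans (pos-there {z} {y} (without z L) λ { refl → ℕP.<-irrefl refl z<y }) (pos-without-after L L! z<y)

  pos-fetchL-≥ : ∀ {L : List (Fin n)} {y z} → IsList L → y ≢ z → pos L y ℕ.≤ pos (fetchL L z) y
  pos-fetchL-≥ {L} {y} {z} L↭ y≢z with ℕP.<-cmp (pos L y) (pos L z)
  ... | tri< y<z _ _ = ℕP.≤-trans (ℕP.n≤1+n _) (ℕP.≤-reflexive (sym (pos-fetchL-before L y<z)))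
  ... | tri≈ _ y≡z _ = contradiction (pos-injective L (IsList⇒∈ L↭ y) y≡z) y≢z
  ... | tri> _ _ z<y = ℕP.≤-reflexive (sym (pos-fetchL-after L (IsList⇒Unique L↭) z<y))

  fetchL-↭ : ∀ (L : List (Fin n)) {z} → Unique L → z ∈ L → fetchL L z ↭ L
  fetchL-↭ (w ∷ L) {z} (w∉L ∷ L!) z∈ with w ≟ z
  ... | yes refl = ↭.prep w (↭.↭-reflexive (without-∉ w∉L))
  ... | no w≢z with z∈
  ...   | here z≡w   = contradiction (sym z≡w) w≢z
  ...   | there z∈L = ↭.trans (↭.swap z w ↭.refl) (↭.prep w (fetchL-↭ L L! z∈L))

  sumOf-pos≤ : ∀ (L : List (Fin n)) m {c} → Unique L → 0ℚ ≤ c →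
               sumOf L (λ y → when (pos L y ℕ.≤? m) c) ≤ ⟦ m ⟧ * c
  sumOf-pos≤ []      m       _         0≤c = 0≤* (0≤⟦⟧ m) 0≤c
  sumOf-pos≤ (v ∷ L) zero    {c} _          0≤c = ℚP.≤-reflexive (begin
    when (pos (v ∷ L) v ℕ.≤? 0) c + sumOf L (λ y → when (pos (v ∷ L) y ℕ.≤? 0) c)
      ≡⟨ cong₂ _+_ (when-no (ℕP.<⇒≱ (1≤pos (v ∷ L) v)) (pos (v ∷ L) v ℕ.≤? 0))
                   (sumOf-zero L λ y _ → when-no (ℕP.<⇒≱ (1≤pos (v ∷ L) y)) (pos (v ∷ L) y ℕ.≤? 0)) ⟩
    0ℚ + 0ℚ                  ≡⟨ ℚP.*-zeroˡ c ⟨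
    ⟦ 0 ⟧ * c                ∎)
    where open ≡-Reasoning
  sumOf-pos≤ (v ∷ L) (suc m) {c} (v∉L ∷ L!) 0≤c = begin
    when (pos (v ∷ L) v ℕ.≤? suc m) c + sumOf L (λ y → when (pos (v ∷ L) y ℕ.≤? suc m) c)
      ≡⟨ cong₂ _+_ (when-yes (subst (ℕ._≤ suc m) (sym (pos-head v L)) (s≤s z≤n)) (pos (v ∷ L) v ℕ.≤? suc m)) (sumOf-cong L shift) ⟩
    c + sumOf L (λ y → when (pos L y ℕ.≤? m) c)  ≤⟨ ℚP.+-monoʳ-≤ c (sumOf-pos≤ L m L! 0≤c) ⟩
    c + ⟦ m ⟧ * c                                 ≡⟨ solve 2 (λ c k → c :+ k :* c := (con ⟦ 1 ⟧ :+ k) :* c) refl c ⟦ m ⟧ ⟩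
    (⟦ 1 ⟧ + ⟦ m ⟧) * c                           ≡⟨ cong (_* c) (⟦+⟧ 1 m) ⟨
    ⟦ suc m ⟧ * c                                 ∎
    where
    open ℚP.≤-Reasoning
    shift : ∀ y → y ∈ L → when (pos (v ∷ L) y ℕ.≤? suc m) c ≡ when (pos L y ℕ.≤? m) c
    shift y y∈L rewrite pos-there L (λ v≡y → All.lookup v∉L y∈L v≡y) = when-⇔ ℕP.≤-pred s≤s (suc (pos L y) ℕ.≤? suc m) (pos L y ℕ.≤? m)

minPos-attained : ∀ {n} (L* : List (Fin n)) R → 1 ℕ.≤ length R → ∃ λ u → u ∈ R × minPos L* R ≡ pos L* u
minPos-attained L* (u ∷ [])    _ = u , here refl , refl
minPos-attained L* (u ∷ v ∷ R) _ with ℕP.⊓-sel (pos L* u) (minPos L* (v ∷ R)) | minPos-attained L* (v ∷ R) (s≤s z≤n)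
... | inj₁ min≡u | _                 = u , here refl , min≡u
... | inj₂ min≡  | w , w∈R , min≡w  = w , there w∈R , trans min≡ min≡w

-- The potential of a single element

module Potential (r : ℕ) where

  private instance
    2^κ≢0 : ℕ.NonZero (2 ^ κ r)
    2^κ≢0 = ℕP.m^n≢0 2 (κ r)

  threshold : ℕ → ℕ
  threshold P* = pexp P* ℕ.+ κ r

  φ : ℕ → ℕ → ℚ → ℚ
  φ P P* b with pexp P ℕ.≤? threshold P*
  ... | yes _ = α * b
  ... | no _  = β r * ⟦ P ⟧ - γ r * b

  ψ : ℕ → ℕ → ℚ
  ψ P P* with pexp P ℕ.<? threshold P*
  ... | yes _ = 0ℚ
  ... | no _  = ⟦ 2 ⟧ * β r * ⟦ qrem P ⟧

  -- pot P P* b is Φ_z + Ψ_z for an element z at DLM position P and Off position P* with budget b.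
  pot : ℕ → ℕ → ℚ → ℚ
  pot P P* b = φ P P* b + ψ P P*

  module _ (P P* : ℕ) where

    φ-≤ : ∀ {b} → pexp P ℕ.≤ threshold P* → φ P P* b ≡ α * b
    φ-≤ p≤t with pexp P ℕ.≤? threshold P*
    ... | yes _   = refl
    ... | no p≰t = contradiction p≤t p≰t

    φ-> : ∀ {b} → threshold P* ℕ.< pexp P → φ P P* b ≡ β r * ⟦ P ⟧ - γ r * b
    φ-> t<p with pexp P ℕ.≤? threshold P*
    ... | yes p≤t = contradiction p≤t (ℕP.<⇒≱ t<p)
    ... | no _    = refl

    ψ-< : pexp P ℕ.< threshold P* → ψ P P* ≡ 0ℚ
    ψ-< p<t with pexp P ℕ.<? threshold P*
    ... | yes _   = refl
    ... | no p≮t = contradiction p<t p≮t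

    ψ-≥ : threshold P* ℕ.≤ pexp P → ψ P P* ≡ ⟦ 2 ⟧ * β r * ⟦ qrem P ⟧
    ψ-≥ t≤p with pexp P ℕ.<? threshold P*
    ... | yes p<t = contradiction t≤p (ℕP.<⇒≱ p<t)
    ... | no _    = refl

    ψ-qrem≡0 : qrem P ≡ 0 → ψ P P* ≡ 0ℚ
    ψ-qrem≡0 q≡0 with pexp P ℕ.<? threshold P*
    ... | yes _ = refl
    ... | no _  rewrite q≡0 = ℚP.*-zeroʳ (⟦ 2 ⟧ * β r)

    0≤ψ : 0ℚ ≤ ψ P P*
    0≤ψ with pexp P ℕ.<? threshold P*
    ... | yes _ = ℚP.≤-refl
    ... | no _  = 0≤* (0≤* (0≤⟦⟧ 2) (0≤β r)) (0≤⟦⟧ (qrem P))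

  0≤3β : 0ℚ ≤ ⟦ 3 ⟧ * β r
  0≤3β = 0≤* (0≤⟦⟧ 3) (0≤β r)

  pot-front : ∀ P* → pot 1 P* 0ℚ ≡ 0ℚ
  pot-front P* = cong₂ _+_ (φ-≤ 1 P* {0ℚ} z≤n) (ψ-< 1 P* (ℕP.≤-trans (κ-pos r) (ℕP.m≤n+m (κ r) (pexp P*))))

  module _ (P P* : ℕ) {b : ℚ} where

    pot-low : pexp P ℕ.< threshold P* → pot P P* b ≡ α * b + 0ℚ
    pot-low p<t = cong₂ _+_ (φ-≤ P P* (ℕP.<⇒≤ p<t)) (ψ-< P P* p<t)

    pot-edge : pexp P ≡ threshold P* → pot P P* b ≡ α * b + ⟦ 2 ⟧ * β r * ⟦ qrem P ⟧
    pot-edge p≡t = cong₂ _+_ (φ-≤ P P* (ℕP.≤-reflexive p≡t)) (ψ-≥ P P* (ℕP.≤-reflexive (sym p≡t)))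

    pot-high : threshold P* ℕ.< pexp P → pot P P* b ≡ β r * ⟦ P ⟧ - γ r * b + ⟦ 2 ⟧ * β r * ⟦ qrem P ⟧
    pot-high t<p = cong₂ _+_ (φ-> P P* t<p) (ψ-≥ P P* (ℕP.<⇒≤ t<p))

    pot-notHigh-≥ : pexp P ℕ.≤ threshold P* → α * b ≤ pot P P* b
    pot-notHigh-≥ p≤t = ≤-by-gap (ψ P P*) (0≤ψ P P*) (cong (_+ ψ P P*) (sym (φ-≤ P P* p≤t)))

    pot-high-≥ : threshold P* ℕ.< pexp P → ⟦ 2 ⟧ * b ≤ ⟦ 3 ⟧ * ⟦ P ⟧ → ⟦ 5 ⟧ * ⟦ P ⟧ ≤ pot P P* b
    pot-high-≥ t<p 2b≤3P = begin
      ⟦ 5 ⟧ * ⟦ P ⟧                   ≤⟨ *-cancelˡ-≤-2 doubled ⟩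
      β r * ⟦ P ⟧ - γ r * b           ≤⟨ ≤-by-gap (ψ P P*) (0≤ψ P P*) refl ⟩
      β r * ⟦ P ⟧ - γ r * b + ψ P P*  ≡⟨ cong (_+ ψ P P*) (φ-> P P* t<p) ⟨
      pot P P* b                      ∎
      where
      open ℚP.≤-Reasoning
      doubled : ⟦ 2 ⟧ * (⟦ 5 ⟧ * ⟦ P ⟧) ≤ ⟦ 2 ⟧ * (β r * ⟦ P ⟧ - γ r * b)
      doubled = ≤-by-gap (⟦ 5 ⟧ * ⟦ r ⟧ * (⟦ 3 ⟧ * ⟦ P ⟧ - ⟦ 2 ⟧ * b))
        (0≤* (0≤* (0≤⟦⟧ 5) (0≤⟦⟧ r)) (0≤- 2b≤3P))
        (trans (solve 3 (λ R P b →
                   con ⟦ 2 ⟧ :* (con ⟦ 5 ⟧ :* P) :+ con ⟦ 5 ⟧ :* R :* (con ⟦ 3 ⟧ :* P :- con ⟦ 2 ⟧ :* b)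
                     := (con ⟦ 15 ⟧ :* R :+ con ⟦ 10 ⟧) :* P :- con ⟦ 2 ⟧ :* (con ⟦ 5 ⟧ :* R :* b)) refl ⟦ r ⟧ ⟦ P ⟧ b)
        (trans (cong₂ (λ B G → B * ⟦ P ⟧ - ⟦ 2 ⟧ * (G * b)) (sym (β*2≡ r)) (sym (γ≡ r)))
               (solve 4 (λ B G P b → B :* con ⟦ 2 ⟧ :* P :- con ⟦ 2 ⟧ :* (G :* b)
                                       := con ⟦ 2 ⟧ :* (B :* P :- G :* b)) refl (β r) (γ r) ⟦ P ⟧ b)))

    pot-nonneg : 0ℚ ≤ b → ⟦ 2 ⟧ * b ≤ ⟦ 3 ⟧ * ⟦ P ⟧ → 0ℚ ≤ pot P P* b
    pot-nonneg 0≤b 2b≤3P =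
      [ (λ p≤t → ℚP.≤-trans (0≤* (0≤⟦⟧ 2) 0≤b) (pot-notHigh-≥ p≤t))
      , (λ t<p → ℚP.≤-trans (0≤* (0≤⟦⟧ 5) (0≤⟦⟧ P)) (pot-high-≥ t<p 2b≤3P))
      ]′ (ℕP.≤-<-connex (pexp P) (threshold P*))

    pot-≥-2P : ⟦ P ⟧ ≤ b → ⟦ 2 ⟧ * b ≤ ⟦ 3 ⟧ * ⟦ P ⟧ → ⟦ 2 ⟧ * ⟦ P ⟧ ≤ pot P P* b
    pot-≥-2P P≤b 2b≤3P =
      [ (λ p≤t → ℚP.≤-trans (*-monoˡ-≤-0≤ (0≤⟦⟧ 2) P≤b) (pot-notHigh-≥ p≤t))
      , (λ t<p → ℚP.≤-trans (ℚP.*-monoʳ-≤-nonNeg ⟦ P ⟧ {{ℚ.nonNegative (0≤⟦⟧ P)}} (⟦⟧-mono-≤ {2} {5} (s≤s (s≤s z≤n))))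
                            (pot-high-≥ t<p 2b≤3P))
      ]′ (ℕP.≤-<-connex (pexp P) (threshold P*))

    pot-raise-high : ∀ δ → threshold P* ℕ.< pexp P → pot P P* (b + δ) + γ r * δ ≡ pot P P* b
    pot-raise-high δ t<p = begin
      φ P P* (b + δ) + ψ P P* + γ r * δ              ≡⟨ cong (λ x → x + ψ P P* + γ r * δ) (φ-> P P* t<p) ⟩
      β r * ⟦ P ⟧ - γ r * (b + δ) + ψ P P* + γ r * δ ≡⟨ solve 6 (λ B G P b δ Y → B :* P :- G :* (b :+ δ) :+ Y :+ G :* δ := B :* P :- G :* b :+ Y)
                                                          refl (β r) (γ r) ⟦ P ⟧ b δ (ψ P P*) ⟩
      β r * ⟦ P ⟧ - γ r * b + ψ P P*                 ≡⟨ cong (_+ ψ P P*) (φ-> P P* t<p) ⟨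
      pot P P* b                                     ∎
      where open ≡-Reasoning

    pot-raise : ∀ {δ} → 0ℚ ≤ δ → pot P P* (b + δ) ≤ pot P P* b + α * δ
    pot-raise {δ} 0≤δ = byZone (ℕP.≤-<-connex (pexp P) (threshold P*))
      where
      byZone : pexp P ℕ.≤ threshold P* ⊎ threshold P* ℕ.< pexp P → pot P P* (b + δ) ≤ pot P P* b + α * δ
      byZone (inj₁ p≤t) = ℚP.≤-reflexive (begin
        φ P P* (b + δ) + ψ P P*    ≡⟨ cong (_+ ψ P P*) (φ-≤ P P* p≤t) ⟩
        α * (b + δ) + ψ P P*       ≡⟨ solve 4 (λ a b δ Y → a :* (b :+ δ) :+ Y := a :* b :+ Y :+ a :* δ) refl α b δ (ψ P P*) ⟩
        α * b + ψ P P* + α * δ     ≡⟨ cong (λ x → x + ψ P P* + α * δ) (φ-≤ P P* p≤t) ⟨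
        pot P P* b + α * δ         ∎)
        where open ≡-Reasoning
      byZone (inj₂ t<p) = ≤-by-gap ((γ r + α) * δ) (0≤* (0≤+ (0≤γ r) (0≤⟦⟧ 2)) 0≤δ)
        (trans (solve 4 (λ x g a d → x :+ (g :+ a) :* d := x :+ g :* d :+ a :* d) refl (pot P P* (b + δ)) (γ r) α δ)
               (cong (_+ α * δ) (pot-raise-high δ t<p)))

  pot-moveBack-sameBlock : ∀ P P* {b} → pexp (suc P) ≡ pexp P → qrem (suc P) ≡ suc (qrem P) →
                           pot (suc P) P* b ≤ pot P P* b + ⟦ 3 ⟧ * β r
  pot-moveBack-sameBlock P P* {b} p′≡p q′≡1+q = byZone (ℕP.<-cmp (pexp P) (threshold P*))
    where
    byZone : Tri (pexp P ℕ.< threshold P*) (pexp P ≡ threshold P*) (threshold P* ℕ.< pexp P) →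
             pot (suc P) P* b ≤ pot P P* b + ⟦ 3 ⟧ * β r
    byZone (tri< p<t _ _) = begin
      pot (suc P) P* b                ≡⟨ pot-low (suc P) P* (subst (ℕ._< threshold P*) (sym p′≡p) p<t) ⟩
      α * b + 0ℚ                      ≤⟨ ≤-by-gap (⟦ 3 ⟧ * β r) 0≤3β refl ⟩
      α * b + 0ℚ + ⟦ 3 ⟧ * β r        ≡⟨ cong (_+ ⟦ 3 ⟧ * β r) (pot-low P P* p<t) ⟨
      pot P P* b + ⟦ 3 ⟧ * β r        ∎
      where open ℚP.≤-Reasoning
    byZone (tri≈ _ p≡t _) = begin
      pot (suc P) P* b                                   ≡⟨ pot-edge (suc P) P* (trans p′≡p p≡t) ⟩
      α * b + ⟦ 2 ⟧ * β r * ⟦ qrem (suc P) ⟧             ≡⟨ cong (λ q → α * b + ⟦ 2 ⟧ * β r * q) (trans (cong ⟦_⟧ q′≡1+q) (⟦+⟧ 1 (qrem P))) ⟩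
      α * b + ⟦ 2 ⟧ * β r * (⟦ 1 ⟧ + ⟦ qrem P ⟧)         ≤⟨ ≤-by-gap (β r) (0≤β r) (solve 3 (λ b B Q →
                                                              con α :* b :+ con ⟦ 2 ⟧ :* B :* (con ⟦ 1 ⟧ :+ Q) :+ B
                                                                := con α :* b :+ con ⟦ 2 ⟧ :* B :* Q :+ con ⟦ 3 ⟧ :* B)
                                                              refl b (β r) ⟦ qrem P ⟧) ⟩
      α * b + ⟦ 2 ⟧ * β r * ⟦ qrem P ⟧ + ⟦ 3 ⟧ * β r     ≡⟨ cong (_+ ⟦ 3 ⟧ * β r) (pot-edge P P* p≡t) ⟨
      pot P P* b + ⟦ 3 ⟧ * β r                           ∎
      where open ℚP.≤-Reasoning
    byZone (tri> _ _ t<p) = begin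
      pot (suc P) P* b                                                    ≡⟨ pot-high (suc P) P* (subst (threshold P* ℕ.<_) (sym p′≡p) t<p) ⟩
      β r * ⟦ suc P ⟧ - γ r * b + ⟦ 2 ⟧ * β r * ⟦ qrem (suc P) ⟧          ≡⟨ cong₂ (λ p q → β r * p - γ r * b + ⟦ 2 ⟧ * β r * q)
                                                                               (⟦+⟧ 1 P) (trans (cong ⟦_⟧ q′≡1+q) (⟦+⟧ 1 (qrem P))) ⟩
      β r * (⟦ 1 ⟧ + ⟦ P ⟧) - γ r * b + ⟦ 2 ⟧ * β r * (⟦ 1 ⟧ + ⟦ qrem P ⟧) ≡⟨ solve 5 (λ B G P b Q →
                                                                               B :* (con ⟦ 1 ⟧ :+ P) :- G :* b :+ con ⟦ 2 ⟧ :* B :* (con ⟦ 1 ⟧ :+ Q)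
                                                                                 := B :* P :- G :* b :+ con ⟦ 2 ⟧ :* B :* Q :+ con ⟦ 3 ⟧ :* B)
                                                                               refl (β r) (γ r) ⟦ P ⟧ b ⟦ qrem P ⟧ ⟩
      β r * ⟦ P ⟧ - γ r * b + ⟦ 2 ⟧ * β r * ⟦ qrem P ⟧ + ⟦ 3 ⟧ * β r        ≡⟨ cong (_+ ⟦ 3 ⟧ * β r) (pot-high P P* t<p) ⟨
      pot P P* b + ⟦ 3 ⟧ * β r                                            ∎
      where open ℚP.≤-Reasoning

  pot-moveBack-newBlock : ∀ P P* {b} → 0ℚ ≤ b → pexp (suc P) ≡ suc (pexp P) → qrem (suc P) ≡ 0 →
                          suc P ≡ 2 ℕ.* suc (qrem P) → pot (suc P) P* b ≤ pot P P* b + ⟦ 3 ⟧ * β r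
  pot-moveBack-newBlock P P* {b} 0≤b p′≡1+p q′≡0 1+P≡ = byZone (ℕP.<-cmp (pexp P) (threshold P*))
    where
    byZone : Tri (pexp P ℕ.< threshold P*) (pexp P ≡ threshold P*) (threshold P* ℕ.< pexp P) →
             pot (suc P) P* b ≤ pot P P* b + ⟦ 3 ⟧ * β r
    byZone (tri< p<t _ _) = begin
      pot (suc P) P* b                ≡⟨ cong₂ _+_ (φ-≤ (suc P) P* (subst (ℕ._≤ threshold P*) (sym p′≡1+p) p<t))
                                                   (ψ-qrem≡0 (suc P) P* q′≡0) ⟩
      α * b + 0ℚ                      ≤⟨ ≤-by-gap (⟦ 3 ⟧ * β r) 0≤3β refl ⟩
      α * b + 0ℚ + ⟦ 3 ⟧ * β r        ≡⟨ cong (_+ ⟦ 3 ⟧ * β r) (pot-low P P* p<t) ⟨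
      pot P P* b + ⟦ 3 ⟧ * β r        ∎
      where open ℚP.≤-Reasoning
    byZone (tri≈ _ p≡t _) = begin
      pot (suc P) P* b                                    ≡⟨ cong₂ _+_ (φ-> (suc P) P* (subst (threshold P* ℕ.<_) (sym p′≡1+p) (s≤s (ℕP.≤-reflexive (sym p≡t)))))
                                                                  (ψ-qrem≡0 (suc P) P* q′≡0) ⟩
      β r * ⟦ suc P ⟧ - γ r * b + 0ℚ                      ≡⟨ cong (λ p → β r * p - γ r * b + 0ℚ) ⟦1+P⟧≡ ⟩
      β r * (⟦ 2 ⟧ * (⟦ 1 ⟧ + ⟦ qrem P ⟧)) - γ r * b + 0ℚ  ≤⟨ ≤-by-gap ((α + γ r) * b + β r) (0≤+ (0≤* (0≤+ (0≤⟦⟧ 2) (0≤γ r)) 0≤b) (0≤β r))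
                                                               (solve 4 (λ B G b Q →
                                                                 B :* (con ⟦ 2 ⟧ :* (con ⟦ 1 ⟧ :+ Q)) :- G :* b :+ con 0ℚ :+ ((con α :+ G) :* b :+ B)
                                                                   := con α :* b :+ con ⟦ 2 ⟧ :* B :* Q :+ con ⟦ 3 ⟧ :* B)
                                                                 refl (β r) (γ r) b ⟦ qrem P ⟧) ⟩
      α * b + ⟦ 2 ⟧ * β r * ⟦ qrem P ⟧ + ⟦ 3 ⟧ * β r      ≡⟨ cong (_+ ⟦ 3 ⟧ * β r) (pot-edge P P* p≡t) ⟨
      pot P P* b + ⟦ 3 ⟧ * β r                            ∎
      where
      open ℚP.≤-Reasoning
      ⟦1+P⟧≡ : ⟦ suc P ⟧ ≡ ⟦ 2 ⟧ * (⟦ 1 ⟧ + ⟦ qrem P ⟧)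
      ⟦1+P⟧≡ = trans (cong ⟦_⟧ 1+P≡) (trans (⟦*⟧ 2 (suc (qrem P))) (cong (⟦ 2 ⟧ *_) (⟦+⟧ 1 (qrem P))))
    byZone (tri> _ _ t<p) = begin
      pot (suc P) P* b                                                 ≡⟨ cong₂ _+_ (φ-> (suc P) P* (subst (threshold P* ℕ.<_) (sym p′≡1+p) (ℕP.m<n⇒m<1+n t<p)))
                                                                               (ψ-qrem≡0 (suc P) P* q′≡0) ⟩
      β r * ⟦ suc P ⟧ - γ r * b + 0ℚ                                   ≡⟨ cong (λ p → β r * p - γ r * b + 0ℚ) (⟦+⟧ 1 P) ⟩
      β r * (⟦ 1 ⟧ + ⟦ P ⟧) - γ r * b + 0ℚ                             ≤⟨ ≤-by-gap (⟦ 2 ⟧ * β r * ⟦ qrem P ⟧ + ⟦ 2 ⟧ * β r)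
                                                                            (0≤+ (0≤* 0≤2β (0≤⟦⟧ (qrem P))) 0≤2β)
                                                                            (solve 5 (λ B G P b Q →
                                                                              B :* (con ⟦ 1 ⟧ :+ P) :- G :* b :+ con 0ℚ :+ (con ⟦ 2 ⟧ :* B :* Q :+ con ⟦ 2 ⟧ :* B)
                                                                                := B :* P :- G :* b :+ con ⟦ 2 ⟧ :* B :* Q :+ con ⟦ 3 ⟧ :* B)
                                                                              refl (β r) (γ r) ⟦ P ⟧ b ⟦ qrem P ⟧) ⟩
      β r * ⟦ P ⟧ - γ r * b + ⟦ 2 ⟧ * β r * ⟦ qrem P ⟧ + ⟦ 3 ⟧ * β r     ≡⟨ cong (_+ ⟦ 3 ⟧ * β r) (pot-high P P* t<p) ⟨
      pot P P* b + ⟦ 3 ⟧ * β r                                         ∎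
      where
      open ℚP.≤-Reasoning
      0≤2β = 0≤* (0≤⟦⟧ 2) (0≤β r)

  pot-moveBack-≤ : ∀ P P* {b} → 1 ℕ.≤ P → 0ℚ ≤ b → pot (suc P) P* b ≤ pot P P* b + ⟦ 3 ⟧ * β r
  pot-moveBack-≤ P P* {b} 1≤P 0≤b = byBlock (dyadicSucc P 1≤P)
    where
    byBlock : DyadicSucc P → pot (suc P) P* b ≤ pot P P* b + ⟦ 3 ⟧ * β r
    byBlock (same-block p′≡p q′≡1+q)     = pot-moveBack-sameBlock P P* p′≡p q′≡1+q
    byBlock (new-block p′≡1+p q′≡0 1+P≡) = pot-moveBack-newBlock P P* 0≤b p′≡1+p q′≡0 1+P≡

  chargeLimit : ℕ → ℕ
  chargeLimit M = M ℕD./ 2 ^ κ r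

  charge : ℕ → ℕ → ℚ
  charge M P* = when (P* ℕ.≤? chargeLimit M) (⟦ 3 ⟧ * β r)

  -- Moving back can raise pot only if p(P + 1) ≥ p* + κ, which forces 2^κ·P* < 2(P + 1) ≤ M.
  pot-moveBack : ∀ P P* {b} M → 1 ℕ.≤ P → 0ℚ ≤ b → 2 ℕ.* suc P ℕ.≤ M →
                 pot (suc P) P* b ≤ pot P P* b + charge M P*
  pot-moveBack P P* {b} M 1≤P 0≤b 2[1+P]≤M =
    [ unchargedMove , chargedMove ]′ (ℕP.<-≤-connex (pexp (suc P)) (threshold P*))
    where
    unchargedMove : pexp (suc P) ℕ.< threshold P* → pot (suc P) P* b ≤ pot P P* b + charge M P*
    unchargedMove p′<t = ≤-by-gap (charge M P*) (when-nonneg (P* ℕ.≤? chargeLimit M) 0≤3β) (cong (_+ charge M P*) unchanged)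
      where
      p<t = ℕP.≤-<-trans (⌊log₂⌋-mono-≤ (ℕP.n≤1+n P)) p′<t
      unchanged : pot (suc P) P* b ≡ pot P P* b
      unchanged = trans (pot-low (suc P) P* p′<t) (sym (pot-low P P* p<t))
    chargedMove : threshold P* ℕ.≤ pexp (suc P) → pot (suc P) P* b ≤ pot P P* b + charge M P*
    chargedMove t≤p′ = subst (λ c → pot (suc P) P* b ≤ pot P P* b + c)
                         (sym (when-yes P*≤ (P* ℕ.≤? chargeLimit M))) (pot-moveBack-≤ P P* 1≤P 0≤b)
      where
      K*P*<M : 2 ^ κ r ℕ.* P* ℕ.< M
      K*P*<M = ℕP.<-≤-trans (dyadic-scale-< (κ r) 0 (s≤s z≤n)
                              (subst (threshold P* ℕ.≤_) (sym (ℕP.+-identityʳ _)) t≤p′))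
                            2[1+P]≤M
      P*≤ : P* ℕ.≤ chargeLimit M
      P*≤ = begin
        P*                             ≡⟨ ℕD.m*n/n≡m P* (2 ^ κ r) ⟨
        P* ℕ.* 2 ^ κ r ℕD./ 2 ^ κ r    ≤⟨ ℕD./-monoˡ-≤ (2 ^ κ r) (ℕP.≤-trans (ℕP.≤-reflexive (ℕP.*-comm P* _)) (ℕP.<⇒≤ K*P*<M)) ⟩
        M ℕD./ 2 ^ κ r                 ∎
        where open ℕP.≤-Reasoning

  charge-total : ∀ M → ⟦ chargeLimit (2 ℕ.* M) ⟧ * (⟦ 3 ⟧ * β r) ≤ ⟦ M ⟧
  charge-total M = *-cancelˡ-≤-2 (begin
    ⟦ 2 ⟧ * (⟦ m ⟧ * (⟦ 3 ⟧ * β r))  ≡⟨ solve 2 (λ x b → con ⟦ 2 ⟧ :* (x :* (con ⟦ 3 ⟧ :* b)) := x :* (con ⟦ 6 ⟧ :* b)) refl ⟦ m ⟧ (β r) ⟩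
    ⟦ m ⟧ * (⟦ 6 ⟧ * β r)            ≤⟨ *-monoˡ-≤-0≤ (0≤⟦⟧ m) (6β≤2^κ r) ⟩
    ⟦ m ⟧ * ⟦ 2 ^ κ r ⟧              ≡⟨ ⟦*⟧ m (2 ^ κ r) ⟨
    ⟦ m ℕ.* 2 ^ κ r ⟧                ≤⟨ ⟦⟧-mono-≤ (ℕD.m/n*n≤m (2 ℕ.* M) (2 ^ κ r)) ⟩
    ⟦ 2 ℕ.* M ⟧                      ≡⟨ ⟦*⟧ 2 M ⟩
    ⟦ 2 ⟧ * ⟦ M ⟧                    ∎)
    where
    open ℚP.≤-Reasoning
    m = chargeLimit (2 ℕ.* M)

-- Budgets and the invariant of DLM's states

module _ {n : ℕ} where
  open DecMem using (_∈?_)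

  setB-self : ∀ (b : Fin n → ℚ) z v → setB b z v z ≡ v
  setB-self b z v with z ≟ z
  ... | yes _   = refl
  ... | no z≢z = contradiction refl z≢z

  setB-other : ∀ (b : Fin n → ℚ) {z} v {y} → y ≢ z → setB b z v y ≡ b y
  setB-other b {z} v {y} y≢z with y ≟ z
  ... | yes y≡z = contradiction y≡z y≢z
  ... | no _    = refl

  raise-self : ∀ R x δ (b : Fin n → ℚ) → raise R x δ b x ≡ b x
  raise-self R x δ b with x ∈? R | x ≟ x
  ... | _     | no x≢x = contradiction refl x≢x
  ... | yes _ | yes _  = refl
  ... | no _  | yes _  = refl

  raise-∈ : ∀ {R x} δ (b : Fin n → ℚ) {y} → y ∈ R → y ≢ x → raise R x δ b y ≡ b y + δ
  raise-∈ {R} {x} δ b {y} y∈R y≢x with y ∈? R | y ≟ x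
  ... | no y∉R | _       = contradiction y∈R y∉R
  ... | yes _  | yes y≡x = contradiction y≡x y≢x
  ... | yes _  | no _    = refl

  raise-∉ : ∀ {R x} δ (b : Fin n → ℚ) {y} → y ∉ R → raise R x δ b y ≡ b y
  raise-∉ {R} δ b {y} y∉R with y ∈? R
  ... | yes y∈R = contradiction y∈R y∉R
  ... | no _    = refl

2*divℕ≤ : ∀ a {s} → 2 ℕ.≤ s → ⟦ 2 ⟧ * divℕ a s ≤ ⟦ a ⟧
2*divℕ≤ a {suc k} 2≤s = begin
  ⟦ 2 ⟧ * divℕ a (suc k)        ≤⟨ ℚP.*-monoʳ-≤-nonNeg (divℕ a (suc k)) {{ℚ.nonNegative (0≤divℕ a (suc k))}} (⟦⟧-mono-≤ 2≤s) ⟩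
  ⟦ suc k ⟧ * divℕ a (suc k)    ≡⟨ ℚP.*-comm ⟦ suc k ⟧ (divℕ a (suc k)) ⟩
  divℕ a (suc k) * ⟦ suc k ⟧    ≡⟨ divℕ-*-cancel a (s≤s z≤n) ⟩
  ⟦ a ⟧                         ∎
  where open ℚP.≤-Reasoning

two-distinct : ∀ {a} {A : Set a} {x y : A} {R : List A} → x ∈ R → y ∈ R → y ≢ x → 2 ℕ.≤ length R
two-distinct {R = _ ∷ []}    (here refl) (here refl) y≢x = contradiction refl y≢x
two-distinct {R = _ ∷ _ ∷ _} _           _           _   = s≤s (s≤s z≤n)

-- Budgets are at most k/2 times the position: k = 2 between steps, k = 3 inside DLM's loop.
record Invariant {n} (k : ℕ) (s : State {n}) : Set where
  field
    isList  : IsList (lst s)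
    nonneg  : ∀ z → 0ℚ ≤ bud s z
    bounded : ∀ z → ⟦ 2 ⟧ * bud s z ≤ ⟦ k ⟧ * ⟦ pos (lst s) z ⟧
open Invariant

Invariant-weaken : ∀ {n k k′} {s : State {n}} → k ℕ.≤ k′ → Invariant k s → Invariant k′ s
Invariant-weaken {s = s} k≤k′ inv = record
  { isList  = isList inv
  ; nonneg  = nonneg inv
  ; bounded = λ z → ℚP.≤-trans (bounded inv z)
                      (ℚP.*-monoʳ-≤-nonNeg ⟦ pos (lst s) z ⟧ {{ℚ.nonNegative (0≤⟦⟧ (pos (lst s) z))}} (⟦⟧-mono-≤ k≤k′))
  }

module _ {n : ℕ} where
  open DecMem using (_∈?_)

  fetchS : State {n} → Fin n → State {n}
  fetchS s z = ⟨ fetchL (lst s) z , setB (bud s) z 0ℚ ⟩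

  served : List (Fin n) → Fin n → State {n} → State {n}
  served R x s = ⟨ fetchL (lst s) x , raise R x (divℕ (pos (lst s) x) (length R)) (setB (bud s) x 0ℚ) ⟩

  fetch-invariant : ∀ {k s} z → Invariant k s → Invariant k (fetchS s z)
  fetch-invariant {k} {s} z inv = record
    { isList  = ↭.trans (fetchL-↭ (lst s) (IsList⇒Unique (isList inv)) (IsList⇒∈ (isList inv) z)) (isList inv)
    ; nonneg  = λ y → nonneg′ y (y ≟ z)
    ; bounded = λ y → bounded′ y (y ≟ z)
    }
    where
    nonneg′ : ∀ y → Dec (y ≡ z) → 0ℚ ≤ setB (bud s) z 0ℚ y
    nonneg′ y (yes refl) = ℚP.≤-reflexive (sym (setB-self (bud s) z 0ℚ))
    nonneg′ y (no y≢z)  = subst (0ℚ ≤_) (sym (setB-other (bud s) 0ℚ y≢z)) (nonneg inv y)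
    bounded′ : ∀ y → Dec (y ≡ z) → ⟦ 2 ⟧ * setB (bud s) z 0ℚ y ≤ ⟦ k ⟧ * ⟦ pos (fetchL (lst s) z) y ⟧
    bounded′ y (yes refl) = ℚP.≤-trans (ℚP.≤-reflexive (trans (cong (⟦ 2 ⟧ *_) (setB-self (bud s) z 0ℚ)) (ℚP.*-zeroʳ ⟦ 2 ⟧)))
                                       (0≤* (0≤⟦⟧ k) (0≤⟦⟧ (pos (fetchL (lst s) z) z)))
    bounded′ y (no y≢z)  = subst (λ v → ⟦ 2 ⟧ * v ≤ ⟦ k ⟧ * ⟦ pos (fetchL (lst s) z) y ⟧) (sym (setB-other (bud s) 0ℚ y≢z))
      (ℚP.≤-trans (bounded inv y) (*-monoˡ-≤-0≤ (0≤⟦⟧ k) (⟦⟧-mono-≤ (pos-fetchL-≥ (isList inv) y≢z))))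

  loop-invariant : ∀ {s c s'} → Loop s c s' → Invariant 3 s → Invariant 2 s'
  loop-invariant (done below)   inv = record
    { isList  = isList inv
    ; nonneg  = nonneg inv
    ; bounded = λ z → *-monoˡ-≤-0≤ (0≤⟦⟧ 2) (ℚP.<⇒≤ (below z))
    }
  loop-invariant (step z _ rest) inv = loop-invariant rest (fetch-invariant z inv)

  serve-invariant : ∀ {R x s} → IsFirst (lst s) R x → Invariant 2 s → Invariant 3 (served R x s)
  serve-invariant {R} {x} {s} (x∈R , x-first) inv = record
    { isList  = isList (fetch-invariant x inv)
    ; nonneg  = λ y → nonneg′ y (y ≟ x) (y ∈? R)
    ; bounded = λ y → bounded′ y (y ≟ x) (y ∈? R)
    }
    where
    L = lst s
    b = bud s
    δ = divℕ (pos L x) (length R)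
    b′ = raise R x δ (setB b x 0ℚ)
    P≤P′ : ∀ {y} → y ≢ x → ⟦ pos L y ⟧ ≤ ⟦ pos (fetchL L x) y ⟧
    P≤P′ y≢x = ⟦⟧-mono-≤ (pos-fetchL-≥ (isList inv) y≢x)
    at-x : b′ x ≡ 0ℚ
    at-x = trans (raise-self R x δ (setB b x 0ℚ)) (setB-self b x 0ℚ)
    in-R : ∀ {y} → y ∈ R → y ≢ x → b′ y ≡ b y + δ
    in-R y∈R y≢x = trans (raise-∈ δ (setB b x 0ℚ) y∈R y≢x) (cong (_+ δ) (setB-other b 0ℚ y≢x))
    not-in-R : ∀ {y} → y ∉ R → y ≢ x → b′ y ≡ b y
    not-in-R y∉R y≢x = trans (raise-∉ δ (setB b x 0ℚ) y∉R) (setB-other b 0ℚ y≢x)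

    nonneg′ : ∀ y → Dec (y ≡ x) → Dec (y ∈ R) → 0ℚ ≤ b′ y
    nonneg′ y (yes refl) _         = ℚP.≤-reflexive (sym at-x)
    nonneg′ y (no y≢x)  (yes y∈R) = subst (0ℚ ≤_) (sym (in-R y∈R y≢x)) (0≤+ (nonneg inv y) (0≤divℕ (pos L x) (length R)))
    nonneg′ y (no y≢x)  (no y∉R)  = subst (0ℚ ≤_) (sym (not-in-R y∉R y≢x)) (nonneg inv y)

    bounded′ : ∀ y → Dec (y ≡ x) → Dec (y ∈ R) → ⟦ 2 ⟧ * b′ y ≤ ⟦ 3 ⟧ * ⟦ pos (fetchL L x) y ⟧
    bounded′ y (yes refl) _ = subst (λ v → ⟦ 2 ⟧ * v ≤ ⟦ 3 ⟧ * ⟦ pos (fetchL L x) x ⟧) (sym at-x)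
      (ℚP.≤-trans (ℚP.≤-reflexive (ℚP.*-zeroʳ ⟦ 2 ⟧)) (0≤* (0≤⟦⟧ 3) (0≤⟦⟧ (pos (fetchL L x) x))))
    bounded′ y (no y≢x) (yes y∈R) = subst (λ v → ⟦ 2 ⟧ * v ≤ ⟦ 3 ⟧ * ⟦ pos (fetchL L x) y ⟧) (sym (in-R y∈R y≢x)) (begin
      ⟦ 2 ⟧ * (b y + δ)                       ≡⟨ ℚP.*-distribˡ-+ ⟦ 2 ⟧ (b y) δ ⟩
      ⟦ 2 ⟧ * b y + ⟦ 2 ⟧ * δ                 ≤⟨ ℚP.+-mono-≤ (bounded inv y)
                                                   (ℚP.≤-trans (2*divℕ≤ (pos L x) (two-distinct x∈R y∈R y≢x))
                                                               (⟦⟧-mono-≤ (x-first y y∈R))) ⟩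
      ⟦ 2 ⟧ * ⟦ pos L y ⟧ + ⟦ pos L y ⟧       ≡⟨ solve 1 (λ P → con ⟦ 2 ⟧ :* P :+ P := con ⟦ 3 ⟧ :* P) refl ⟦ pos L y ⟧ ⟩
      ⟦ 3 ⟧ * ⟦ pos L y ⟧                     ≤⟨ *-monoˡ-≤-0≤ (0≤⟦⟧ 3) (P≤P′ y≢x) ⟩
      ⟦ 3 ⟧ * ⟦ pos (fetchL L x) y ⟧          ∎)
      where open ℚP.≤-Reasoning
    bounded′ y (no y≢x) (no y∉R) = subst (λ v → ⟦ 2 ⟧ * v ≤ ⟦ 3 ⟧ * ⟦ pos (fetchL L x) y ⟧) (sym (not-in-R y∉R y≢x))
      (ℚP.≤-trans (bounded (Invariant-weaken {k′ = 3} (s≤s (s≤s z≤n)) inv) y) (*-monoˡ-≤-0≤ (0≤⟦⟧ 3) (P≤P′ y≢x)))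

  reachable-invariant : ∀ {r} {s : State {n}} → Reachable r s → Invariant 2 s
  reachable-invariant (init L L↭) = record
    { isList  = L↭
    ; nonneg  = λ _ → ℚP.≤-refl
    ; bounded = λ z → ℚP.≤-trans (ℚP.≤-reflexive (ℚP.*-zeroʳ ⟦ 2 ⟧)) (0≤* (0≤⟦⟧ 2) (0≤⟦⟧ (pos L z)))
    }
  reachable-invariant (next R _ reach (serve x x-first loop)) =
    loop-invariant loop (serve-invariant x-first (reachable-invariant reach))

-- Amortised cost of a step

module Amortised {n : ℕ} (r : ℕ) (L* : List (Fin n)) where
  open Potential r
  open Indicators (_≟_ {n = n})
  open DecMem using (_∈?_)

  potAt : State {n} → Fin n → ℚ
  potAt s y = pot (pos (lst s) y) (pos L* y) (bud s y)

  Pot : State {n} → ℚ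
  Pot s = Σᵤ (potAt s)

  Φ+Ψ≡Pot : ∀ s → Φ r s L* + Ψ r s L* ≡ Pot s
  Φ+Ψ≡Pot s = trans (sym (sumOf-+ (allFin n) (Φz r s L*) (Ψz r s L*)))
                    (sumOf-cong (allFin n) λ y _ → cong₂ _+_ (Φz≡φ y) (Ψz≡ψ y))
    where
    Φz≡φ : ∀ y → Φz r s L* y ≡ φ (pos (lst s) y) (pos L* y) (bud s y)
    Φz≡φ y with pexp (pos (lst s) y) ℕ.≤? threshold (pos L* y)
    ... | yes _ = refl
    ... | no _  = refl
    Ψz≡ψ : ∀ y → Ψz r s L* y ≡ ψ (pos (lst s) y) (pos L* y)
    Ψz≡ψ y with pexp (pos (lst s) y) ℕ.<? threshold (pos L* y)
    ... | yes _ = refl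
    ... | no _  = refl

  Σ-charge-≤ : IsList L* → ∀ M → Σᵤ (λ y → charge (2 ℕ.* M) (pos L* y)) ≤ ⟦ M ⟧
  Σ-charge-≤ L*↭ M = begin
    sumOf (allFin n) chargeOf                 ≡⟨ sumOf-↭ chargeOf (↭.↭-sym L*↭) ⟩
    sumOf L* chargeOf                         ≤⟨ sumOf-pos≤ L* (chargeLimit (2 ℕ.* M)) (IsList⇒Unique L*↭) 0≤3β ⟩
    ⟦ chargeLimit (2 ℕ.* M) ⟧ * (⟦ 3 ⟧ * β r) ≤⟨ charge-total M ⟩
    ⟦ M ⟧                                     ∎
    where
    open ℚP.≤-Reasoning
    chargeOf = λ y → charge (2 ℕ.* M) (pos L* y)

  fetch-amortised : IsList L* → ∀ {s} z → IsList (lst s) → (∀ y → 0ℚ ≤ bud s y) →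
                    Pot (fetchS s z) + potAt s z ≤ Pot s + ⟦ pos (lst s) z ⟧
  fetch-amortised L*↭ {s} z L↭ 0≤b = begin
    Pot s₁ + potAt s z                                  ≡⟨ cong (Pot s₁ +_) (sumOf-point z (potAt s z) (allFin⁺ n) (∈-allFin z)) ⟨
    Pot s₁ + Σᵤ (λ y → when (y ≟ z) (potAt s z))        ≡⟨ sumOf-+ (allFin n) (potAt s₁) (λ y → when (y ≟ z) (potAt s z)) ⟨
    Σᵤ (λ y → potAt s₁ y + when (y ≟ z) (potAt s z))    ≤⟨ sumOf-mono (allFin n) (λ y → per-element y (y ≟ z)) ⟩
    Σᵤ (λ y → potAt s y + charge (2 ℕ.* P) (pos L* y))  ≡⟨ sumOf-+ (allFin n) (potAt s) (λ y → charge (2 ℕ.* P) (pos L* y)) ⟩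
    Pot s + Σᵤ (λ y → charge (2 ℕ.* P) (pos L* y))      ≤⟨ ℚP.+-monoʳ-≤ (Pot s) (Σ-charge-≤ L*↭ P) ⟩
    Pot s + ⟦ P ⟧                                       ∎
    where
    open ℚP.≤-Reasoning
    L = lst s
    b = bud s
    P = pos L z
    s₁ = fetchS s z

    moved : ∀ y → y ≢ z → Tri (pos L y ℕ.< P) (pos L y ≡ P) (P ℕ.< pos L y) →
            potAt s₁ y + 0ℚ ≤ potAt s y + charge (2 ℕ.* P) (pos L* y)
    moved y y≢z (tri< y<z _ _) = begin
      potAt s₁ y + 0ℚ                          ≡⟨ ℚP.+-identityʳ (potAt s₁ y) ⟩
      potAt s₁ y                               ≡⟨ cong₂ (λ p v → pot p (pos L* y) v) (pos-fetchL-before L y<z) (setB-other b 0ℚ y≢z) ⟩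
      pot (suc (pos L y)) (pos L* y) (b y)     ≤⟨ pot-moveBack (pos L y) (pos L* y) (2 ℕ.* P) (1≤pos L y) (0≤b y) (ℕP.*-monoʳ-≤ 2 y<z) ⟩
      potAt s y + charge (2 ℕ.* P) (pos L* y)  ∎
    moved y y≢z (tri≈ _ y≡z _) = contradiction (pos-injective L (IsList⇒∈ L↭ y) y≡z) y≢z
    moved y y≢z (tri> _ _ z<y) = begin
      potAt s₁ y + 0ℚ                          ≡⟨ ℚP.+-identityʳ (potAt s₁ y) ⟩
      potAt s₁ y                               ≡⟨ cong₂ (λ p v → pot p (pos L* y) v) (pos-fetchL-after L (IsList⇒Unique L↭) z<y) (setB-other b 0ℚ y≢z) ⟩
      potAt s y                                ≤⟨ ≤-by-gap (charge (2 ℕ.* P) (pos L* y)) (when-nonneg (pos L* y ℕ.≤? chargeLimit (2 ℕ.* P)) 0≤3β) refl ⟩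
      potAt s y + charge (2 ℕ.* P) (pos L* y)  ∎

    per-element : ∀ y (d : Dec (y ≡ z)) → potAt s₁ y + when d (potAt s z) ≤ potAt s y + charge (2 ℕ.* P) (pos L* y)
    per-element y (yes refl) = begin
      potAt s₁ z + potAt s z    ≡⟨ cong (_+ potAt s z) (trans (cong₂ (λ p v → pot p (pos L* z) v) (pos-fetchL-self L z) (setB-self b z 0ℚ))
                                                            (pot-front (pos L* z))) ⟩
      0ℚ + potAt s z            ≡⟨ ℚP.+-identityˡ (potAt s z) ⟩
      potAt s z                 ≤⟨ ≤-by-gap (charge (2 ℕ.* P) (pos L* z)) (when-nonneg (pos L* z ℕ.≤? chargeLimit (2 ℕ.* P)) 0≤3β) refl ⟩
      potAt s z + charge (2 ℕ.* P) (pos L* z) ∎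
    per-element y (no y≢z) = moved y y≢z (ℕP.<-cmp (pos L y) P)

  -- The fetched element's pot, at least 2P, pays for the P ∸ 1 swaps and for the at most P gained
  -- by the elements it overtakes.
  fetch-pays : IsList L* → ∀ {s} z → Invariant 3 s → ⟦ pos (lst s) z ⟧ ≤ bud s z →
               ⟦ pos (lst s) z ℕ.∸ 1 ⟧ + Pot (fetchS s z) ≤ Pot s
  fetch-pays L*↭ {s} z inv P≤b = absorb (⟦⟧-mono-≤ (ℕP.m∸n≤m P 1)) (pot-≥-2P P (pos L* z) P≤b (bounded inv z))
                                        (fetch-amortised L*↭ z (isList inv) (nonneg inv))
    where
    P = pos (lst s) z
    absorb : ∀ {a P Y S p} → a ≤ P → ⟦ 2 ⟧ * P ≤ p → Y + p ≤ S + P → a + Y ≤ S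
    absorb {a} {P} {Y} {S} {p} a≤P 2P≤p Y+p≤S+P = ≤-by-gap ((P - a) + (S + P - (Y + p)) + (p - ⟦ 2 ⟧ * P))
      (0≤+ (0≤+ (0≤- a≤P) (0≤- Y+p≤S+P)) (0≤- 2P≤p))
      (solve 5 (λ a P Y S p → a :+ Y :+ ((P :- a) :+ (S :+ P :- (Y :+ p)) :+ (p :- con ⟦ 2 ⟧ :* P)) := S) refl a P Y S p)

  loop-amortised : IsList L* → ∀ {s c s'} → Loop s c s' → Invariant 3 s → ⟦ c ⟧ + Pot s' ≤ Pot s
  loop-amortised L*↭ {s} (done _) _ = ℚP.≤-reflexive (ℚP.+-identityˡ (Pot s))
  loop-amortised L*↭ {s} {s' = s'} (step {c = c} z P≤b rest) inv = begin
    ⟦ P ℕ.∸ 1 ℕ.+ c ⟧ + Pot s'          ≡⟨ cong (_+ Pot s') (⟦+⟧ (P ℕ.∸ 1) c) ⟩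
    ⟦ P ℕ.∸ 1 ⟧ + ⟦ c ⟧ + Pot s'        ≡⟨ ℚP.+-assoc ⟦ P ℕ.∸ 1 ⟧ ⟦ c ⟧ (Pot s') ⟩
    ⟦ P ℕ.∸ 1 ⟧ + (⟦ c ⟧ + Pot s')      ≤⟨ ℚP.+-monoʳ-≤ ⟦ P ℕ.∸ 1 ⟧ (loop-amortised L*↭ rest (fetch-invariant z inv)) ⟩
    ⟦ P ℕ.∸ 1 ⟧ + Pot (fetchS s z)      ≤⟨ fetch-pays L*↭ z inv P≤b ⟩
    Pot s                               ∎
    where
    open ℚP.≤-Reasoning
    P = pos (lst s) z

  potAt-raise-≤ : ∀ {L b} R x {δ} → 0ℚ ≤ δ → ∀ y (d : Dec (y ∈ R)) → Dec (y ≡ x) →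
               potAt ⟨ L , raise R x δ b ⟩ y ≤ potAt ⟨ L , b ⟩ y + when d (α * δ)
  potAt-raise-≤ {L} {b} R x {δ} 0≤δ y (yes _) (yes refl) =
    ≤-by-gap (α * δ) (0≤* (0≤⟦⟧ 2) 0≤δ) (cong (λ v → pot (pos L x) (pos L* x) v + α * δ) (raise-self R x δ b))
  potAt-raise-≤ {L} {b} R x {δ} 0≤δ y (yes y∈R) (no y≢x) =
    subst (λ v → pot (pos L y) (pos L* y) v ≤ potAt ⟨ L , b ⟩ y + α * δ) (sym (raise-∈ δ b y∈R y≢x))
          (pot-raise (pos L y) (pos L* y) 0≤δ)
  potAt-raise-≤ {L} {b} R x {δ} 0≤δ y (no y∉R) _ =
    ℚP.≤-reflexive (trans (cong (pot (pos L y) (pos L* y)) (raise-∉ δ b y∉R)) (sym (ℚP.+-identityʳ (potAt ⟨ L , b ⟩ y))))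

  Σ-raised-≤ : ∀ s R {δ} → 0ℚ ≤ δ →
               Σᵤ (λ y → potAt s y + when (y ∈? R) (α * δ)) ≤ Pot s + ⟦ length R ⟧ * (α * δ)
  Σ-raised-≤ s R {δ} 0≤δ = begin
    Σᵤ (λ y → potAt s y + when (y ∈? R) (α * δ))     ≡⟨ sumOf-+ (allFin n) (potAt s) (λ y → when (y ∈? R) (α * δ)) ⟩
    Pot s + Σᵤ (λ y → when (y ∈? R) (α * δ))         ≤⟨ ℚP.+-monoʳ-≤ (Pot s) (sumOf-member-≤ R (α * δ) (allFin⁺ n) ∈-allFin (0≤* (0≤⟦⟧ 2) 0≤δ)) ⟩
    Pot s + ⟦ length R ⟧ * (α * δ)                   ∎
    where open ℚP.≤-Reasoning

  raise-amortised : ∀ {L b} R x {δ} → 0ℚ ≤ δ →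
                    Pot ⟨ L , raise R x δ b ⟩ ≤ Pot ⟨ L , b ⟩ + ⟦ length R ⟧ * (α * δ)
  raise-amortised {L} {b} R x 0≤δ =
    ℚP.≤-trans (sumOf-mono (allFin n) (λ y → potAt-raise-≤ {L} {b} R x 0≤δ y (y ∈? R) (y ≟ x))) (Σ-raised-≤ ⟨ L , b ⟩ R 0≤δ)

  raise-amortised-high : ∀ {L b} R x {δ u} → 0ℚ ≤ δ → u ∈ R → u ≢ x → threshold (pos L* u) ℕ.< pexp (pos L u) →
                         Pot ⟨ L , raise R x δ b ⟩ + (α + γ r) * δ ≤ Pot ⟨ L , b ⟩ + ⟦ length R ⟧ * (α * δ)
  raise-amortised-high {L} {b} R x {δ} {u} 0≤δ u∈R u≢x u-high = begin
    Pot s′ + C                                      ≡⟨ cong (Pot s′ +_) (sumOf-point u C (allFin⁺ n) (∈-allFin u)) ⟨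
    Pot s′ + Σᵤ (λ y → when (y ≟ u) C)              ≡⟨ sumOf-+ (allFin n) (potAt s′) (λ y → when (y ≟ u) C) ⟨
    Σᵤ (λ y → potAt s′ y + when (y ≟ u) C)          ≤⟨ sumOf-mono (allFin n) (λ y → per-element y (y ≟ u)) ⟩
    Σᵤ (λ y → potAt s y + when (y ∈? R) (α * δ))    ≤⟨ Σ-raised-≤ s R 0≤δ ⟩
    Pot s + ⟦ length R ⟧ * (α * δ)                  ∎
    where
    open ℚP.≤-Reasoning
    s = ⟨ L , b ⟩
    s′ = ⟨ L , raise R x δ b ⟩
    C = (α + γ r) * δ
    per-element : ∀ y (d : Dec (y ≡ u)) → potAt s′ y + when d C ≤ potAt s y + when (y ∈? R) (α * δ)
    per-element y (yes refl) = ℚP.≤-reflexive (begin-equality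
      potAt s′ u + C                                        ≡⟨ cong (λ v → pot (pos L u) (pos L* u) v + C) (raise-∈ δ b u∈R u≢x) ⟩
      pot (pos L u) (pos L* u) (b u + δ) + C                ≡⟨ solve 4 (λ p a g d → p :+ (a :+ g) :* d := p :+ g :* d :+ a :* d)
                                                                 refl (pot (pos L u) (pos L* u) (b u + δ)) α (γ r) δ ⟩
      pot (pos L u) (pos L* u) (b u + δ) + γ r * δ + α * δ  ≡⟨ cong (_+ α * δ) (pot-raise-high (pos L u) (pos L* u) δ u-high) ⟩
      potAt s u + α * δ                                     ≡⟨ cong (potAt s u +_) (when-yes u∈R (u ∈? R)) ⟨
      potAt s u + when (u ∈? R) (α * δ)                     ∎)
    per-element y (no _) = ℚP.≤-trans (ℚP.≤-reflexive (ℚP.+-identityʳ (potAt s′ y))) (potAt-raise-≤ {L} {b} R x 0≤δ y (y ∈? R) (y ≟ x))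

  accounting : ∀ a c s sₘ s' {B} → ⟦ a ⟧ + Pot sₘ ≤ Pot s + B → ⟦ c ⟧ + Pot s' ≤ Pot sₘ →
               ⟦ a ℕ.+ c ⟧ + (Φ r s' L* - Φ r s L*) + (Ψ r s' L* - Ψ r s L*) ≤ B
  accounting a c s sₘ s' {B} served looped = begin
    ⟦ a ℕ.+ c ⟧ + (Φ r s' L* - Φ r s L*) + (Ψ r s' L* - Ψ r s L*)
      ≡⟨ trans (cong (λ v → v + (Φ r s' L* - Φ r s L*) + (Ψ r s' L* - Ψ r s L*)) (⟦+⟧ a c))
               (solve 6 (λ A C F₀ S₀ F₁ S₁ → A :+ C :+ (F₁ :- F₀) :+ (S₁ :- S₀) := A :+ C :+ (F₁ :+ S₁) :- (F₀ :+ S₀))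
                      refl ⟦ a ⟧ ⟦ c ⟧ (Φ r s L*) (Ψ r s L*) (Φ r s' L*) (Ψ r s' L*)) ⟩
    ⟦ a ⟧ + ⟦ c ⟧ + (Φ r s' L* + Ψ r s' L*) - (Φ r s L* + Ψ r s L*)
      ≡⟨ cong₂ (λ u v → ⟦ a ⟧ + ⟦ c ⟧ + u - v) (Φ+Ψ≡Pot s') (Φ+Ψ≡Pot s) ⟩
    ⟦ a ⟧ + ⟦ c ⟧ + Pot s' - Pot s
      ≤⟨ ≤-by-gap ((Pot s + B - (⟦ a ⟧ + Pot sₘ)) + (Pot sₘ - (⟦ c ⟧ + Pot s'))) (0≤+ (0≤- served) (0≤- looped))
           (solve 6 (λ A C P₀ Pₘ P₁ B → A :+ C :+ P₁ :- P₀ :+ ((P₀ :+ B :- (A :+ Pₘ)) :+ (Pₘ :- (C :+ P₁))) := B)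
                  refl ⟦ a ⟧ ⟦ c ⟧ (Pot s) (Pot sₘ) (Pot s') B) ⟩
    B ∎
    where open ℚP.≤-Reasoning

  -- u is the element of R accessed by Off.  Either Off's cost bounds ℓ, or u is in the high zone and
  -- the step is paid by pot(x) ≥ 5ℓ (u = x) or by the fall of pot(u) under the budget raise (u ≠ x).
  module Serve (L*↭ : IsList L*) {R x} {s : State {n}} (R-valid : ValidReq r R) (x-first : IsFirst (lst s) R x)
               (inv : Invariant 2 s) where

    L : List (Fin n)
    L = lst s

    ℓ : ℕ
    ℓ = pos L x

    δ : ℚ
    δ = divℕ ℓ (length R)

    s₁ sₘ : State {n}
    s₁ = fetchS s x
    sₘ = served R x s

    bound : ℚ
    bound = (⟦ 3 ⟧ + α) * ⟦ 2 ^ (κ r ℕ.+ 1) ⟧ * ⟦ minPos L* R ⟧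

    0≤δ : 0ℚ ≤ δ
    0≤δ = 0≤divℕ ℓ (length R)

    0≤bound : 0ℚ ≤ bound
    0≤bound = 0≤* (0≤* (0≤+ (0≤⟦⟧ 3) (0≤⟦⟧ 2)) (0≤⟦⟧ (2 ^ (κ r ℕ.+ 1)))) (0≤⟦⟧ (minPos L* R))

    δ*|R|≡ℓ : δ * ⟦ length R ⟧ ≡ ⟦ ℓ ⟧
    δ*|R|≡ℓ = divℕ-*-cancel ℓ (proj₁ (proj₂ R-valid))

    2b≤3P : ∀ z → ⟦ 2 ⟧ * bud s z ≤ ⟦ 3 ⟧ * ⟦ pos L z ⟧
    2b≤3P = bounded (Invariant-weaken {k′ = 3} (s≤s (s≤s z≤n)) inv)

    0≤potAt-x : 0ℚ ≤ potAt s x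
    0≤potAt-x = pot-nonneg ℓ (pos L* x) (nonneg inv x) (2b≤3P x)

    serve-accounting : ∀ C → Pot sₘ + C ≤ Pot s₁ + ⟦ length R ⟧ * (α * δ) →
                       (⟦ 3 ⟧ + α) * ⟦ ℓ ⟧ ≤ potAt s x + C + bound →
                       ⟦ ℓ ℕ.+ (ℓ ℕ.∸ 1) ⟧ + Pot sₘ ≤ Pot s + bound
    serve-accounting C raised paid = ≤-by-gap gap
      (0≤+ (0≤+ (0≤+ (0≤- cost≤2ℓ) (0≤- raised′)) (0≤- fetched)) (0≤- paid))
      (solve 8 (λ a M C S₁ p S l B →
        a :+ M :+ ((con ⟦ 2 ⟧ :* l :- a) :+ (S₁ :+ con α :* l :- (M :+ C)) :+ (S :+ l :- (S₁ :+ p))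
                   :+ (p :+ C :+ B :- (con ⟦ 3 ⟧ :+ con α) :* l))
          := S :+ B) refl ⟦ ℓ ℕ.+ (ℓ ℕ.∸ 1) ⟧ (Pot sₘ) C (Pot s₁) (potAt s x) (Pot s) ⟦ ℓ ⟧ bound)
      where
      fetched : Pot s₁ + potAt s x ≤ Pot s + ⟦ ℓ ⟧
      fetched = fetch-amortised L*↭ x (isList inv) (nonneg inv)
      raised′ : Pot sₘ + C ≤ Pot s₁ + α * ⟦ ℓ ⟧
      raised′ = subst (λ v → Pot sₘ + C ≤ Pot s₁ + v)
        (trans (solve 3 (λ k a d → k :* (a :* d) := a :* (d :* k)) refl ⟦ length R ⟧ α δ) (cong (α *_) δ*|R|≡ℓ)) raised
      cost≤2ℓ : ⟦ ℓ ℕ.+ (ℓ ℕ.∸ 1) ⟧ ≤ ⟦ 2 ⟧ * ⟦ ℓ ⟧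
      cost≤2ℓ = ℚP.≤-trans (⟦⟧-mono-≤ (ℕP.+-monoʳ-≤ ℓ (ℕP.≤-trans (ℕP.m∸n≤m ℓ 1) (ℕP.≤-reflexive (sym (ℕP.+-identityʳ ℓ))))))
                           (ℚP.≤-reflexive (⟦*⟧ 2 ℓ))
      gap = (⟦ 2 ⟧ * ⟦ ℓ ⟧ - ⟦ ℓ ℕ.+ (ℓ ℕ.∸ 1) ⟧) + (Pot s₁ + α * ⟦ ℓ ⟧ - (Pot sₘ + C))
            + (Pot s + ⟦ ℓ ⟧ - (Pot s₁ + potAt s x)) + (potAt s x + C + bound - (⟦ 3 ⟧ + α) * ⟦ ℓ ⟧)

    raised : Pot sₘ + 0ℚ ≤ Pot s₁ + ⟦ length R ⟧ * (α * δ)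
    raised = ℚP.≤-trans (ℚP.≤-reflexive (ℚP.+-identityʳ (Pot sₘ))) (raise-amortised {fetchL L x} {setB (bud s) x 0ℚ} R x 0≤δ)

    paid-by-Off : ∀ {u} → u ∈ R → minPos L* R ≡ pos L* u → pexp (pos L u) ℕ.≤ threshold (pos L* u) →
                  (⟦ 3 ⟧ + α) * ⟦ ℓ ⟧ ≤ potAt s x + 0ℚ + bound
    paid-by-Off {u} u∈R min≡ u-low = begin
      (⟦ 3 ⟧ + α) * ⟦ ℓ ⟧                                ≤⟨ *-monoˡ-≤-0≤ (0≤+ (0≤⟦⟧ 3) (0≤⟦⟧ 2)) (⟦⟧-mono-≤ ℓ≤) ⟩
      (⟦ 3 ⟧ + α) * ⟦ 2 ^ (κ r ℕ.+ 1) ℕ.* pos L* u ⟧     ≡⟨ trans (cong ((⟦ 3 ⟧ + α) *_) (⟦*⟧ (2 ^ (κ r ℕ.+ 1)) (pos L* u)))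
                                                              (sym (ℚP.*-assoc (⟦ 3 ⟧ + α) ⟦ 2 ^ (κ r ℕ.+ 1) ⟧ ⟦ pos L* u ⟧)) ⟩
      (⟦ 3 ⟧ + α) * ⟦ 2 ^ (κ r ℕ.+ 1) ⟧ * ⟦ pos L* u ⟧   ≡⟨ cong (λ m → (⟦ 3 ⟧ + α) * ⟦ 2 ^ (κ r ℕ.+ 1) ⟧ * ⟦ m ⟧) min≡ ⟨
      bound                                              ≤⟨ ≤-by-gap (potAt s x + 0ℚ) (0≤+ 0≤potAt-x ℚP.≤-refl)
                                                              (ℚP.+-comm bound (potAt s x + 0ℚ)) ⟩
      potAt s x + 0ℚ + bound                             ∎
      where
      open ℚP.≤-Reasoning
      ℓ≤ : ℓ ℕ.≤ 2 ^ (κ r ℕ.+ 1) ℕ.* pos L* u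
      ℓ≤ = ℕP.≤-trans (proj₂ x-first u u∈R) (ℕP.<⇒≤ (subst₂ ℕ._<_ (ℕP.*-identityˡ (pos L u))
             (cong (λ k → 2 ^ k ℕ.* pos L* u) (ℕP.+-comm 1 (κ r)))
             (dyadic-scale-< 0 (κ r) (1≤pos L* u) (subst (ℕ._≤ threshold (pos L* u)) (sym (ℕP.+-identityʳ _)) u-low))))

    paid-by-x : threshold (pos L* x) ℕ.< pexp ℓ → (⟦ 3 ⟧ + α) * ⟦ ℓ ⟧ ≤ potAt s x + 0ℚ + bound
    paid-by-x x-high = begin
      (⟦ 3 ⟧ + α) * ⟦ ℓ ⟧    ≡⟨ solve 1 (λ l → (con ⟦ 3 ⟧ :+ con α) :* l := con ⟦ 5 ⟧ :* l) refl ⟦ ℓ ⟧ ⟩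
      ⟦ 5 ⟧ * ⟦ ℓ ⟧          ≤⟨ pot-high-≥ ℓ (pos L* x) x-high (2b≤3P x) ⟩
      potAt s x              ≡⟨ ℚP.+-identityʳ (potAt s x) ⟨
      potAt s x + 0ℚ         ≤⟨ ≤-by-gap bound 0≤bound refl ⟩
      potAt s x + 0ℚ + bound ∎
      where open ℚP.≤-Reasoning

    raised-high : ∀ {u} → u ∈ R → u ≢ x → threshold (pos L* u) ℕ.< pexp (pos L u) →
                  Pot sₘ + (α + γ r) * δ ≤ Pot s₁ + ⟦ length R ⟧ * (α * δ)
    raised-high {u} u∈R u≢x u-high = raise-amortised-high {fetchL L x} {setB (bud s) x 0ℚ} R x 0≤δ u∈R u≢x
      (subst (λ P → threshold (pos L* u) ℕ.< pexp P) (sym (pos-fetchL-after L (IsList⇒Unique (isList inv)) x<u)) u-high)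
      where
      x<u : ℓ ℕ.< pos L u
      x<u = ℕP.≤∧≢⇒< (proj₂ x-first u u∈R) (λ ℓ≡ → u≢x (sym (pos-injective L (IsList⇒∈ (isList inv) x) ℓ≡)))

    paid-by-raise : (⟦ 3 ⟧ + α) * ⟦ ℓ ⟧ ≤ potAt s x + (α + γ r) * δ + bound
    paid-by-raise = begin
      (⟦ 3 ⟧ + α) * ⟦ ℓ ⟧                   ≡⟨ cong ((⟦ 3 ⟧ + α) *_) δ*|R|≡ℓ ⟨
      (⟦ 3 ⟧ + α) * (δ * ⟦ length R ⟧)      ≤⟨ ≤-by-gap (⟦ 2 ⟧ * δ + ⟦ 5 ⟧ * δ * (⟦ r ⟧ - ⟦ length R ⟧))
                                                 (0≤+ (0≤* (0≤⟦⟧ 2) 0≤δ) (0≤* (0≤* (0≤⟦⟧ 5) 0≤δ) (0≤- (⟦⟧-mono-≤ (proj₂ (proj₂ R-valid))))))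
                                                 (solve 3 (λ d k R → (con ⟦ 3 ⟧ :+ con α) :* (d :* k) :+ (con ⟦ 2 ⟧ :* d :+ con ⟦ 5 ⟧ :* d :* (R :- k))
                                                                      := (con α :+ con ⟦ 5 ⟧ :* R) :* d) refl δ ⟦ length R ⟧ ⟦ r ⟧) ⟩
      (α + ⟦ 5 ⟧ * ⟦ r ⟧) * δ               ≡⟨ cong (λ g → (α + g) * δ) (γ≡ r) ⟨
      (α + γ r) * δ                         ≤⟨ ≤-by-gap (potAt s x + bound) (0≤+ 0≤potAt-x 0≤bound)
                                                 (solve 3 (λ c p b → c :+ (p :+ b) := p :+ c :+ b) refl ((α + γ r) * δ) (potAt s x) bound) ⟩
      potAt s x + (α + γ r) * δ + bound     ∎
      where open ℚP.≤-Reasoning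

    serve-amortised : ⟦ ℓ ℕ.+ (ℓ ℕ.∸ 1) ⟧ + Pot sₘ ≤ Pot s + bound
    serve-amortised = byOffAccess (minPos-attained L* R (proj₁ (proj₂ R-valid)))
      where
      byOffAccess : (∃ λ u → u ∈ R × minPos L* R ≡ pos L* u) → ⟦ ℓ ℕ.+ (ℓ ℕ.∸ 1) ⟧ + Pot sₘ ≤ Pot s + bound
      byOffAccess (u , u∈R , min≡) = byZone (ℕP.≤-<-connex (pexp (pos L u)) (threshold (pos L* u))) (u ≟ x)
        where
        byZone : pexp (pos L u) ℕ.≤ threshold (pos L* u) ⊎ threshold (pos L* u) ℕ.< pexp (pos L u) → Dec (u ≡ x) →
                 ⟦ ℓ ℕ.+ (ℓ ℕ.∸ 1) ⟧ + Pot sₘ ≤ Pot s + bound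
        byZone (inj₁ u-low)  _        = serve-accounting 0ℚ raised (paid-by-Off u∈R min≡ u-low)
        byZone (inj₂ u-high) (yes refl) = serve-accounting 0ℚ raised (paid-by-x u-high)
        byZone (inj₂ u-high) (no u≢x)  = serve-accounting ((α + γ r) * δ) (raised-high u∈R u≢x u-high) paid-by-raise

lemma9 : ∀ {n : ℕ} (r : ℕ) (R : List (Fin n)) (s : State {n}) (L* : List (Fin n))
         (c : ℕ) (s' : State {n}) →
         ValidReq r R → Reachable r s → IsList L* → DLMStep R s c s' →
         ⟦ c ⟧ + (Φ r s' L* - Φ r s L*) + (Ψ r s' L* - Ψ r s L*)
           ≤ (⟦ 3 ⟧ + α) * ⟦ 2 ^ (κ r ℕ.+ 1) ⟧ * ⟦ minPos L* R ⟧
lemma9 r R s L* c s' R-valid s-reachable L*↭ (serve {L} {c = c₁} x x-first loop) =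
  accounting (pos L x ℕ.+ (pos L x ℕ.∸ 1)) c₁ s (served R x s) s'
    (Serve.serve-amortised L*↭ R-valid x-first inv)
    (loop-amortised L*↭ loop (serve-invariant x-first inv))
  where
  open Amortised r L*
  inv = reachable-invariant s-reachable
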